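{- For $f(n)=\Omega(n)$, $\mathrm{NSPACE}[f(n)]\subseteq\mathrm{UNAL}[f(n)]$.
   Context: Convolution pairs strings symbol by symbol, padding shorter ones with a new symbol $\#$; a relation is automatic if the set of convolutions of its tuples is regular (no bound on the length difference between related strings is imposed). An Unbounded Nondeterministic Automatic Register Machine (UNARM) has finitely many registers holding strings over a finite alphabet $\Gamma\supseteq\Sigma$ (initially empty) and a finite program: read the input into a register, write, assign a constant string, copy, assign to a register any value related by an automatic relation to (the convolution of) registers (nondeterministic choice), goto, conditional goto on an automatic predicate, halt/accept/reject; each executed instruction is one step. An input is accepted iff some computation path accepts. $\mathrm{UNAL}[f(n)]$ is the class of languages accepted by a UNARM in at most $O(f(n))$ steps on inputs of length $n$. -}

module Defs where

open import Data.Nat using (ℕ; zero; suc; _*_; _+_; _≤_; _⊔_)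
open import Data.Fin using (Fin; zero; suc)
open import Data.Bool using (Bool; true)
open import Data.Maybe using (Maybe; just; nothing)
import Data.Maybe
open import Data.Sum using (_⊎_; inj₁)
open import Data.Product using (Σ; ∃; _×_; _,_)
open import Data.List using (List; []; _∷_; length)
import Data.List as List
open import Data.Vec using (Vec; []; _∷_; _[_]≔_; lookup; replicate)
import Data.Vec as Vec
open import Relation.Nullary using (¬_)
open import Relation.Binary.PropositionalEquality using (_≡_)
open import Relation.Binary.Construct.Closure.ReflexiveTransitive using (Star)
open import Function.Bundles using (_⇔_)

Language : ℕ → Set₁
Language s = List (Fin s) → Set

IsΩn : (ℕ → ℕ) → Set
IsΩn f = ∃ λ c → ∃ λ n₀ → ∀ n → n₀ ≤ n → n ≤ c * f n

record DFA (A : Set) : Set where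
  field
    nStates : ℕ
    start   : Fin nStates
    δ       : Fin nStates → A → Fin nStates
    final   : Fin nStates → Bool

DFAAccepts : ∀ {A} → DFA A → List A → Set
DFAAccepts D u = DFA.final D (List.foldl (DFA.δ D) (DFA.start D) u) ≡ true

-- Convolution of an r-tuple of strings: position-wise pairing, shorter
-- strings padded with the new symbol # (represented by 'nothing').
-- Its length is the maximum of the lengths.

headM : ∀ {A : Set} → List A → Maybe A
headM []      = nothing
headM (x ∷ _) = just x

tailL : ∀ {A : Set} → List A → List A
tailL []       = []
tailL (_ ∷ xs) = xs

convFuel : ∀ {A : Set} {r} → ℕ → Vec (List A) r → List (Vec (Maybe A) r)
convFuel zero    xs = []
convFuel (suc n) xs = Vec.map headM xs ∷ convFuel n (Vec.map tailL xs)

maxLen : ∀ {A : Set} {r} → Vec (List A) r → ℕ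
maxLen []       = 0
maxLen (x ∷ xs) = length x ⊔ maxLen xs

conv : ∀ {A : Set} {r} → Vec (List A) r → List (Vec (Maybe A) r)
conv xs = convFuel (maxLen xs) xs

AutRel : Set → ℕ → Set
AutRel A r = DFA (Vec (Maybe A) r)

InAutRel : ∀ {A r} → AutRel A r → Vec (List A) r → Set
InAutRel D xs = DFAAccepts D (conv xs)

-- Unbounded Nondeterministic Automatic Register Machines
-- Register alphabet Γ = Σ ⊎ (k extra symbols), so Σ ⊆ Γ.
-- R registers; program of (suc len) instructions labelled by Fin (suc len).

Γsym : ℕ → ℕ → Set
Γsym s k = Fin s ⊎ Fin k

data Instr (s k R n : ℕ) : Set where
  iRead   : Fin R → Instr s k R n
  iWrite  : Fin R → Instr s k R n
  iConst  : Fin R → List (Γsym s k) → Instr s k R n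
  iCopy   : Fin R → Fin R → Instr s k R n
  iAssign : Fin R → AutRel (Γsym s k) (suc R) → Instr s k R n
     -- x_i := any y with (y, x_0, …, x_{R-1}) in the automatic relation
  iGoto   : Fin n → Instr s k R n
  iIfGoto : AutRel (Γsym s k) R → Fin n → Instr s k R n
  iAccept : Instr s k R n
  iReject : Instr s k R n

record UNARM (s : ℕ) : Set where
  field
    k   : ℕ
    R   : ℕ
    len : ℕ
    prog : Fin (suc len) → Instr s k R (suc len)

-- the label following a given one (nothing if we fall off the program: halt, reject)
nextPc : ∀ {n} → Fin n → Maybe (Fin n)
nextPc {suc zero}    zero    = nothing
nextPc {suc (suc n)} zero    = just (suc zero)
nextPc {suc (suc n)} (suc i) = Data.Maybe.map suc (nextPc i)

module _ {s : ℕ} (M : UNARM s) where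
  open UNARM M

  Reg : Set
  Reg = List (Γsym s k)

  record RConfig : Set where
    constructor ⟨_,_⟩
    field
      pc   : Fin (suc len)
      regs : Vec Reg R

  rInit : RConfig
  rInit = ⟨ zero , replicate R [] ⟩

  data RStep (w : List (Fin s)) : RConfig → RConfig → Set where
    sRead   : ∀ {pc pc' rs i} → prog pc ≡ iRead i → nextPc pc ≡ just pc' →
              RStep w ⟨ pc , rs ⟩ ⟨ pc' , rs [ i ]≔ List.map inj₁ w ⟩
    sWrite  : ∀ {pc pc' rs i} → prog pc ≡ iWrite i → nextPc pc ≡ just pc' →
              RStep w ⟨ pc , rs ⟩ ⟨ pc' , rs ⟩
    sConst  : ∀ {pc pc' rs i u} → prog pc ≡ iConst i u → nextPc pc ≡ just pc' →
              RStep w ⟨ pc , rs ⟩ ⟨ pc' , rs [ i ]≔ u ⟩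
    sCopy   : ∀ {pc pc' rs i j} → prog pc ≡ iCopy i j → nextPc pc ≡ just pc' →
              RStep w ⟨ pc , rs ⟩ ⟨ pc' , rs [ i ]≔ lookup rs j ⟩
    sAssign : ∀ {pc pc' rs i D} (y : Reg) → prog pc ≡ iAssign i D →
              InAutRel D (y ∷ rs) → nextPc pc ≡ just pc' →
              RStep w ⟨ pc , rs ⟩ ⟨ pc' , rs [ i ]≔ y ⟩
    sGoto   : ∀ {pc rs l} → prog pc ≡ iGoto l →
              RStep w ⟨ pc , rs ⟩ ⟨ l , rs ⟩
    sIfYes  : ∀ {pc rs D l} → prog pc ≡ iIfGoto D l → InAutRel D rs →
              RStep w ⟨ pc , rs ⟩ ⟨ l , rs ⟩
    sIfNo   : ∀ {pc pc' rs D l} → prog pc ≡ iIfGoto D l → ¬ InAutRel D rs →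
              nextPc pc ≡ just pc' →
              RStep w ⟨ pc , rs ⟩ ⟨ pc' , rs ⟩

  -- AcceptsWithin w t c : some computation path from c on input w executes
  -- an accept instruction, using at most t executed instructions in total
  -- (the accept instruction itself counts as one step).
  data AcceptsWithin (w : List (Fin s)) : ℕ → RConfig → Set where
    here  : ∀ {t pc rs} → prog pc ≡ iAccept → AcceptsWithin w (suc t) ⟨ pc , rs ⟩
    there : ∀ {t c c'} → RStep w c c' → AcceptsWithin w t c' → AcceptsWithin w (suc t) c

  UAccepts : List (Fin s) → Set
  UAccepts w = ∃ λ t → AcceptsWithin w t rInit

UNAL : (f : ℕ → ℕ) → ∀ {s} → Language s → Set
UNAL f {s} L = Σ (UNARM s) λ M →
  (∀ w → L w ⇔ UAccepts M w) ×
  (∃ λ c → ∃ λ n₀ → ∀ w → n₀ ≤ length w → L w →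
     AcceptsWithin M w (c * f (length w)) (rInit M))

-- Nondeterministic single-tape Turing machines (input written on the tape).
-- Tape alphabet: blank (nothing) ⊎ Σ ⊎ k extra symbols.

data Dir : Set where
  left right : Dir

record NTM (s : ℕ) : Set where
  field
    k      : ℕ
    nQ     : ℕ
    q₀     : Fin nQ
    δ      : Fin nQ → Maybe (Fin s ⊎ Fin k) → Fin nQ → Maybe (Fin s ⊎ Fin k) → Dir → Bool
    accQ   : Fin nQ → Bool

module _ {s : ℕ} (M : NTM s) where
  open NTM M

  TSym : Set
  TSym = Maybe (Fin s ⊎ Fin k)

  -- tape zipper: cells left of head (reversed), scanned cell, cells to the right;
  -- the tape holds exactly the cells visited so far (plus the input).
  record TConfig : Set where
    constructor tc
    field
      st  : Fin nQ
      lft : List TSym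
      cur : TSym
      rgt : List TSym

  tInit : List (Fin s) → TConfig
  tInit []       = tc q₀ [] nothing []
  tInit (x ∷ xs) = tc q₀ [] (just (inj₁ x)) (List.map (λ y → just (inj₁ y)) xs)

  data TStep : TConfig → TConfig → Set where
    mvL  : ∀ {p p' x ls a b rs} → δ p a p' b left ≡ true →
           TStep (tc p (x ∷ ls) a rs) (tc p' ls x (b ∷ rs))
    mvL₀ : ∀ {p p' a b rs} → δ p a p' b left ≡ true →
           TStep (tc p [] a rs) (tc p' [] b rs)
    mvR  : ∀ {p p' x ls a b rs} → δ p a p' b right ≡ true →
           TStep (tc p ls a (x ∷ rs)) (tc p' (b ∷ ls) x rs)
    mvR₀ : ∀ {p p' ls a b} → δ p a p' b right ≡ true →
           TStep (tc p ls a []) (tc p' (b ∷ ls) nothing [])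

  space : TConfig → ℕ
  space (tc _ ls _ rs) = length ls + suc (length rs)

  Accepting : TConfig → Set
  Accepting c = accQ (TConfig.st c) ≡ true

  AcceptsInSpace : List (Fin s) → ℕ → Set
  AcceptsInSpace w m = ∃ λ c → Star TStep (tInit w) c × Accepting c × space c ≤ m

  TAccepts : List (Fin s) → Set
  TAccepts w = ∃ λ c → Star TStep (tInit w) c × Accepting c



NSPACE : (f : ℕ → ℕ) → ∀ {s} → Language s → Set
NSPACE f {s} L = Σ (NTM s) λ M →
  (∀ w → L w ⇔ TAccepts M w) ×
  (∃ λ c → ∃ λ n₀ → ∀ w → n₀ ≤ length w → L w →
     AcceptsInSpace M w (c * f (length w)))

-- A nondeterministic machine working in space m is simulated by a register
-- machine that guesses a whole accepting run at once.  The run is written as a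
-- string H of configurations of width m, each followed by a separator, so that
-- every letter of H is determined by the three letters one period m + 2
-- earlier, as in Cook's tableau.  Comparing H with itself shifted by an unknown
-- period is not an automatic relation, but comparing two registers letter by
-- letter is: the machine also guesses a counter of length m + 2, deletes one
-- letter from a copy of H per letter of the counter, and then checks all local
-- conditions with a single automatic predicate.  Every guess costs one step, so
-- only this loop costs time, and the total O(m) is O(f(n)) because f(n) = Ω(n)
-- also pays for the input.

module Submission where

open import Defs
open import Data.Bool using (Bool; true; false; _∧_; _∨_; not; if_then_else_)
open import Data.Bool.Properties using (∧-assoc)
open import Data.Empty using (⊥; ⊥-elim)
open import Data.Fin as Fin using (Fin; zero; suc; #_; _↑ˡ_; _↑ʳ_; splitAt; combine; remQuot)
open import Data.Fin.Properties using (splitAt-↑ˡ; splitAt-↑ʳ; remQuot-combine)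
import Data.Fin.Properties as Fin
open import Data.List.Relation.Unary.All as All using (All; []; _∷_)
open import Data.List.Relation.Unary.All.Properties using (++⁺; map⁺)
open import Data.List using (List; []; _∷_; length; foldl; map; _++_; reverse; replicate; drop; [_])
open import Data.List.Properties
  using (∷-injective; map-++; ++-assoc; unfold-reverse;
         length-map; length-++; length-reverse; length-replicate; map-∘; map-injective)
open import Data.Maybe using (Maybe; just; nothing; is-just; is-nothing)
import Data.Maybe as Maybe
open import Data.Maybe.Properties using (just-injective)
open import Data.Nat using (ℕ; zero; suc; _+_; _*_; _∸_; _≤_; _<_; z≤n; s≤s; s≤s⁻¹; _≤?_)
open import Data.Nat.Properties
open import Data.Nat.Solver using (module +-*-Solver)
open import Algebra.Properties.CommutativeSemigroup +-commutativeSemigroup using (x∙yz≈y∙xz)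
open import Data.Product using (∃; _×_; _,_; proj₁; proj₂)
open import Data.Sum using (_⊎_; inj₁; inj₂)
open import Data.Unit using (⊤; tt)
open import Data.Vec using (Vec; []; _∷_; lookup; _[_]≔_)
import Data.Vec as Vec
open import Data.Vec.Properties using (lookup-map; lookup-replicate)
open import Function.Base using (_∘_)
open import Function.Construct.Composition using (_⇔-∘_)
open import Function.Bundles using (_⇔_; mk⇔; Equivalence)
open import Relation.Binary.Construct.Closure.ReflexiveTransitive using (Star; ε; _◅_)
open import Relation.Binary.Definitions using (Tri; tri<; tri≈; tri>)
open import Relation.Binary.PropositionalEquality hiding ([_])
open import Relation.Nullary using (¬_; yes; no; does)

open Equivalence using (to; from)

record Finite (A : Set) : Set where
  field
    size          : ℕ
    index         : A → Fin size
    element       : Fin size → A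
    element-index : ∀ x → element (index x) ≡ x
open Finite

finite-Fin : ∀ n → Finite (Fin n)
finite-Fin n = record { size = n ; index = λ i → i ; element = λ i → i ; element-index = λ _ → refl }

finite-⊤ : Finite ⊤
finite-⊤ = record { size = 1 ; index = λ _ → zero ; element = λ _ → tt ; element-index = λ _ → refl }

finite-⊎ : ∀ {A B} → Finite A → Finite B → Finite (A ⊎ B)
finite-⊎ {A} {B} FA FB = record
  { size = size FA + size FB ; index = idx ; element = λ i → elt (splitAt (size FA) i)
  ; element-index = inverse }
  where
  idx : A ⊎ B → Fin (size FA + size FB)
  idx (inj₁ a) = index FA a ↑ˡ size FB
  idx (inj₂ b) = size FA ↑ʳ index FB b
  elt : Fin (size FA) ⊎ Fin (size FB) → A ⊎ B
  elt (inj₁ i) = inj₁ (element FA i)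
  elt (inj₂ i) = inj₂ (element FB i)
  inverse : ∀ x → elt (splitAt (size FA) (idx x)) ≡ x
  inverse (inj₁ a) rewrite splitAt-↑ˡ (size FA) (index FA a) (size FB) = cong inj₁ (element-index FA a)
  inverse (inj₂ b) rewrite splitAt-↑ʳ (size FA) (size FB) (index FB b) = cong inj₂ (element-index FB b)

finite-× : ∀ {A B} → Finite A → Finite B → Finite (A × B)
finite-× {A} {B} FA FB = record
  { size = size FA * size FB ; index = λ (a , b) → combine (index FA a) (index FB b)
  ; element = λ i → elt (remQuot {size FA} (size FB) i) ; element-index = inverse }
  where
  elt : Fin (size FA) × Fin (size FB) → A × B
  elt (i , j) = element FA i , element FB j
  inverse : ∀ x → elt (remQuot (size FB) (combine (index FA (proj₁ x)) (index FB (proj₂ x)))) ≡ x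
  inverse (a , b) = trans (cong elt (remQuot-combine (index FA a) (index FB b)))
                          (cong₂ _,_ (element-index FA a) (element-index FB b))

finite-retract : ∀ {A B} (f : A → B) (g : B → A) → (∀ b → f (g b) ≡ b) → Finite A → Finite B
finite-retract f g fg FA = record
  { size = size FA ; index = λ b → index FA (g b) ; element = λ i → f (element FA i)
  ; element-index = λ b → trans (cong f (element-index FA (g b))) (fg b) }

finite-Maybe : ∀ {A} → Finite A → Finite (Maybe A)
finite-Maybe {A} FA = finite-retract fromSum toSum inverse (finite-⊎ finite-⊤ FA)
  where
  fromSum : ⊤ ⊎ A → Maybe A
  fromSum (inj₁ _) = nothing
  fromSum (inj₂ a) = just a
  toSum : Maybe A → ⊤ ⊎ A
  toSum nothing  = inj₁ tt
  toSum (just a) = inj₂ a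
  inverse : ∀ x → fromSum (toSum x) ≡ x
  inverse nothing  = refl
  inverse (just a) = refl

finite-Bool : Finite Bool
finite-Bool = finite-retract is-just (λ b → if b then just tt else nothing) inverse
                             (finite-Maybe finite-⊤)
  where
  inverse : ∀ b → is-just (if b then just tt else nothing) ≡ b
  inverse false = refl
  inverse true  = refl

finite-Dir : Finite Dir
finite-Dir = finite-retract (λ b → if b then left else right) isLeft inverse finite-Bool
  where
  isLeft : Dir → Bool
  isLeft left  = true
  isLeft right = false
  inverse : ∀ d → (if isLeft d then left else right) ≡ d
  inverse left  = refl
  inverse right = refl

finite-Vec : ∀ {A} → Finite A → ∀ r → Finite (Vec A r)
finite-Vec FA zero    = record { size = 1 ; index = λ _ → zero ; element = λ _ → []
                               ; element-index = λ { [] → refl } }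
finite-Vec FA (suc r) = finite-retract (λ (a , v) → a ∷ v) (λ v → Vec.head v , Vec.tail v)
                                       (λ { (a ∷ v) → refl }) (finite-× FA (finite-Vec FA r))

infix 8 _≡ᵇ[_]_

_≡ᵇ[_]_ : ∀ {A : Set} → A → Finite A → A → Bool
x ≡ᵇ[ FA ] y = does (index FA x Fin.≟ index FA y)

≡ᵇ-sound : ∀ {A : Set} (FA : Finite A) {x y} → x ≡ᵇ[ FA ] y ≡ true → x ≡ y
≡ᵇ-sound FA {x} {y} e with index FA x Fin.≟ index FA y
... | yes p = trans (sym (element-index FA x)) (trans (cong (element FA) p) (element-index FA y))

≡ᵇ-refl : ∀ {A : Set} (FA : Finite A) x → x ≡ᵇ[ FA ] x ≡ true
≡ᵇ-refl FA x with index FA x Fin.≟ index FA x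
... | yes _ = refl
... | no ¬p = ⊥-elim (¬p refl)

dfaOn : ∀ {A S : Set} → Finite S → S → (S → A → S) → (S → Bool) → DFA A
dfaOn FS s₀ δ accept = record
  { nStates = size FS ; start = index FS s₀
  ; δ = λ i a → index FS (δ (element FS i) a) ; final = λ i → accept (element FS i) }

dfaOn-run : ∀ {A S : Set} (FS : Finite S) (δ : S → A → S) s (u : List A) →
  element FS (foldl (λ i a → index FS (δ (element FS i) a)) (index FS s) u) ≡ foldl δ s u
dfaOn-run FS δ s []      = element-index FS s
dfaOn-run FS δ s (a ∷ u) rewrite element-index FS s = dfaOn-run FS δ (δ s a) u

dfaOn-accepts : ∀ {A S : Set} (FS : Finite S) s₀ (δ : S → A → S) accept (u : List A) →
  DFAAccepts (dfaOn FS s₀ δ accept) u ⇔ (accept (foldl δ s₀ u) ≡ true)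
dfaOn-accepts FS s₀ δ accept u =
  mk⇔ (trans (cong accept (sym (dfaOn-run FS δ s₀ u)))) (trans (cong accept (dfaOn-run FS δ s₀ u)))

∧-true : ∀ {a b} → a ∧ b ≡ true → a ≡ true × b ≡ true
∧-true {true} {true} _ = refl , refl

true-∧ : ∀ {a b} → a ≡ true → b ≡ true → a ∧ b ≡ true
true-∧ refl refl = refl

cong₃ : ∀ {A B C D : Set} (f : A → B → C → D) {x y z x′ y′ z′} → x ≡ x′ → y ≡ y′ → z ≡ z′ → f x y z ≡ f x′ y′ z′
cong₃ f refl refl refl = refl

_!_ : ∀ {A : Set} → List A → ℕ → Maybe A
[]       ! _     = nothing
(x ∷ xs) ! zero  = just x
(x ∷ xs) ! suc j = xs ! j

module _ {A : Set} where

  !-tail : ∀ (xs : List A) j → tailL xs ! j ≡ xs ! suc j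
  !-tail []       j = refl
  !-tail (x ∷ xs) j = refl

  !-map : ∀ {B : Set} (f : A → B) xs j → map f xs ! j ≡ Maybe.map f (xs ! j)
  !-map f []       j       = refl
  !-map f (x ∷ xs) zero    = refl
  !-map f (x ∷ xs) (suc j) = !-map f xs j

  !-map-just : ∀ {B : Set} (f : A → B) xs {j x} → xs ! j ≡ just x → map f xs ! j ≡ just (f x)
  !-map-just f xs {j} e = trans (!-map f xs j) (cong (Maybe.map f) e)

  !-++ˡ : ∀ (xs ys : List A) {j} → j < length xs → (xs ++ ys) ! j ≡ xs ! j
  !-++ˡ (x ∷ xs) ys {zero}  _       = refl
  !-++ˡ (x ∷ xs) ys {suc j} (s≤s p) = !-++ˡ xs ys p

  !-++ʳ : ∀ (xs ys : List A) {i} j → i ≡ length xs + j → (xs ++ ys) ! i ≡ ys ! j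
  !-++ʳ []       ys j refl = refl
  !-++ʳ (x ∷ xs) ys {suc i} j e = !-++ʳ xs ys j (suc-injective e)

  !-≥ : ∀ (xs : List A) {j} → length xs ≤ j → xs ! j ≡ nothing
  !-≥ []       _       = refl
  !-≥ (x ∷ xs) (s≤s p) = !-≥ xs p

  !-< : ∀ (xs : List A) {j} → j < length xs → ∃ λ x → xs ! j ≡ just x
  !-< (x ∷ xs) {zero}  _       = x , refl
  !-< (x ∷ xs) {suc j} (s≤s p) = !-< xs p

  !-just⇒< : ∀ (xs : List A) j {x} → xs ! j ≡ just x → j < length xs
  !-just⇒< (x ∷ xs) zero    _ = s≤s z≤n
  !-just⇒< (x ∷ xs) (suc j) p = s≤s (!-just⇒< xs j p)

  is-just-!⇒< : ∀ (xs : List A) j → is-just (xs ! j) ≡ true → j < length xs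
  is-just-!⇒< (x ∷ xs) zero    _ = s≤s z≤n
  is-just-!⇒< (x ∷ xs) (suc j) e = s≤s (is-just-!⇒< xs j e)

  <⇒is-just-! : ∀ (xs : List A) {j} → j < length xs → is-just (xs ! j) ≡ true
  <⇒is-just-! (x ∷ xs) {zero}  _       = refl
  <⇒is-just-! (x ∷ xs) {suc j} (s≤s p) = <⇒is-just-! xs p

  !-All : ∀ {P : A → Set} {xs j x} → All P xs → xs ! j ≡ just x → P x
  !-All {j = zero}  (p ∷ _)  refl = p
  !-All {j = suc j} (_ ∷ ps) e    = !-All ps e

  !-nothing⇒≥ : ∀ (xs : List A) j → xs ! j ≡ nothing → length xs ≤ j
  !-nothing⇒≥ []       j       _ = z≤n
  !-nothing⇒≥ (x ∷ xs) (suc j) e = s≤s (!-nothing⇒≥ xs j e)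

  !-drop : ∀ n (xs : List A) j → drop n xs ! j ≡ xs ! (n + j)
  !-drop zero    xs       j = refl
  !-drop (suc n) []       j = refl
  !-drop (suc n) (x ∷ xs) j = !-drop n xs j

  !-replicate : ∀ n (x : A) {j} → j < n → replicate n x ! j ≡ just x
  !-replicate (suc n) x {zero}  _       = refl
  !-replicate (suc n) x {suc j} (s≤s p) = !-replicate n x p

  !-ext : ∀ (xs ys : List A) → (∀ j → xs ! j ≡ ys ! j) → xs ≡ ys
  !-ext []       []       _ = refl
  !-ext []       (y ∷ ys) h with () ← h 0
  !-ext (x ∷ xs) []       h with () ← h 0
  !-ext (x ∷ xs) (y ∷ ys) h = cong₂ _∷_ (just-injective (h 0)) (!-ext xs ys (λ j → h (suc j)))

  !-ext< : ∀ (xs ys : List A) → length xs ≡ length ys → (∀ j → j < length xs → xs ! j ≡ ys ! j) → xs ≡ ys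
  !-ext< []       []       _ _ = refl
  !-ext< (x ∷ xs) (y ∷ ys) e h =
    cong₂ _∷_ (just-injective (h 0 (s≤s z≤n))) (!-ext< xs ys (suc-injective e) (λ j p → h (suc j) (s≤s p)))

  !-last : ∀ (x : A) xs → ∃ λ y → (x ∷ xs) ! length xs ≡ just y × (x ∷ xs) ! suc (length xs) ≡ nothing
  !-last x [] = x , refl , refl
  !-last x (y ∷ xs) = !-last y xs

  !-split : ∀ (xs : List A) j {x} → xs ! j ≡ just x → ∃ λ ys → ∃ λ zs → xs ≡ ys ++ x ∷ zs × length ys ≡ j
  !-split (y ∷ xs) zero    refl = [] , xs , refl , refl
  !-split (y ∷ xs) (suc j) e with !-split xs j e
  ... | ys , zs , refl , refl = y ∷ ys , zs , refl , refl

  !-prefix : ∀ (ys xs : List A) → length ys ≤ length xs → (∀ j → j < length ys → xs ! j ≡ ys ! j) →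
             xs ≡ ys ++ drop (length ys) xs
  !-prefix []       xs       _       _ = refl
  !-prefix (y ∷ ys) (x ∷ xs) (s≤s l) h with h 0 (s≤s z≤n)
  ... | refl = cong (x ∷_) (!-prefix ys xs l (λ j p → h (suc j) (s≤s p)))

  suffix-shorter : ∀ (xs ys : List A) → length ys ≤ length (xs ++ ys)
  suffix-shorter xs ys = subst (length ys ≤_) (sym (length-++ xs)) (m≤n+m (length ys) (length xs))

  length-tailL : ∀ (xs : List A) → xs ≢ [] → suc (length (tailL xs)) ≡ length xs
  length-tailL []       ne = ⊥-elim (ne refl)
  length-tailL (x ∷ xs) _  = refl

  tail-drop : ∀ n (xs : List A) → tailL (drop n xs) ≡ drop (suc n) xs
  tail-drop zero    []       = refl
  tail-drop zero    (x ∷ xs) = refl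
  tail-drop (suc n) []       = refl
  tail-drop (suc n) (x ∷ xs) = tail-drop n xs

column : ∀ {G : Set} {r} → ℕ → Vec (List G) r → Vec (Maybe G) r
column j = Vec.map (_! j)

blank : ∀ {G : Set} {r} → Vec (Maybe G) r
blank = Vec.replicate _ nothing

module _ {G : Set} where

  tails : ∀ {r} → Vec (List G) r → Vec (List G) r
  tails = Vec.map tailL

  lookup-column : ∀ {r} i j (xs : Vec (List G) r) → lookup (column j xs) i ≡ lookup xs i ! j
  lookup-column i j xs = lookup-map i (_! j) xs

  heads≡column-zero : ∀ {r} (xs : Vec (List G) r) → Vec.map headM xs ≡ column 0 xs
  heads≡column-zero []             = refl
  heads≡column-zero ([] ∷ xs)      = cong (nothing ∷_) (heads≡column-zero xs)
  heads≡column-zero ((x ∷ u) ∷ xs) = cong (just x ∷_) (heads≡column-zero xs)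

  column-tails : ∀ {r} j (xs : Vec (List G) r) → column j (tails xs) ≡ column (suc j) xs
  column-tails j []             = refl
  column-tails j ([] ∷ xs)      = cong (nothing ∷_) (column-tails j xs)
  column-tails j ((x ∷ u) ∷ xs) = cong ((u ! j) ∷_) (column-tails j xs)

  column-blank : ∀ {r} (xs : Vec (List G) r) → maxLen xs ≤ 0 → ∀ j → column j xs ≡ blank
  column-blank []             _ j = refl
  column-blank ([] ∷ xs)      p j = cong (nothing ∷_) (column-blank xs p j)
  column-blank ((x ∷ u) ∷ xs) p j with () ← ≤-trans (m≤m⊔n (suc (length u)) (maxLen xs)) p

  maxLen-tails : ∀ {r} n (xs : Vec (List G) r) → maxLen xs ≤ suc n → maxLen (tails xs) ≤ n
  maxLen-tails n []             _ = z≤n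
  maxLen-tails n ([] ∷ xs)      p = maxLen-tails n xs p
  maxLen-tails n ((x ∷ u) ∷ xs) p =
    ⊔-lub (s≤s⁻¹ (≤-trans (m≤m⊔n _ (maxLen xs)) p)) (maxLen-tails n xs (≤-trans (m≤n⊔m _ (maxLen xs)) p))

-- Window automata

module Window {G : Set} {r : ℕ} (FG : Finite G)
              (first : Vec (Maybe G) r → Bool) (next : Vec (Maybe G) r → Vec (Maybe G) r → Bool) where

  Column : Set
  Column = Vec (Maybe G) r

  Adjacent : Vec (List G) r → Set
  Adjacent xs = ∀ j → next (column j xs) (column (suc j) xs) ≡ true

  Accepted : Vec (List G) r → Set
  Accepted xs = first (column 0 xs) ≡ true × Adjacent xs

  private
    okAfter : Maybe Column → Column → Bool
    okAfter nothing  c = first c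
    okAfter (just a) c = next a c

    check : Maybe Column → List Column → Bool
    check p []      = okAfter p blank
    check p (c ∷ u) = okAfter p c ∧ check (just c) u

    step : Maybe Column × Bool → Column → Maybe Column × Bool
    step (p , b) c = just c , b ∧ okAfter p c

    final : Maybe Column × Bool → Bool
    final (p , b) = b ∧ okAfter p blank

    final-run : ∀ p b u → final (foldl step (p , b) u) ≡ b ∧ check p u
    final-run p b []      = refl
    final-run p b (c ∷ u) = trans (final-run (just c) (b ∧ okAfter p c) u) (∧-assoc b _ _)

    adjacent-tails : ∀ xs → (next (column 0 xs) (column 0 (tails xs)) ≡ true × Adjacent (tails xs)) ⇔ Adjacent xs
    adjacent-tails xs = mk⇔
      (λ { (h₀ , h) zero    → subst (λ c → next (column 0 xs) c ≡ true) (column-tails 0 xs) h₀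
         ; (h₀ , h) (suc j) → subst₂ (λ a c → next a c ≡ true) (column-tails j xs) (column-tails (suc j) xs) (h j) })
      (λ h → subst (λ c → next (column 0 xs) c ≡ true) (sym (column-tails 0 xs)) (h 0)
           , λ j → subst₂ (λ a c → next a c ≡ true) (sym (column-tails j xs)) (sym (column-tails (suc j) xs)) (h (suc j)))

    module _ (next-blank : next blank blank ≡ true) where

      check-conv : ∀ n xs → maxLen xs ≤ n → ∀ p →
                   check p (convFuel n xs) ≡ true ⇔ (okAfter p (column 0 xs) ≡ true × Adjacent xs)
      check-conv zero xs empty p = mk⇔
        (λ q → subst (λ c → okAfter p c ≡ true) (sym (blank₀ 0)) q
             , λ j → subst₂ (λ a c → next a c ≡ true) (sym (blank₀ j)) (sym (blank₀ (suc j))) next-blank)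
        (λ q → subst (λ c → okAfter p c ≡ true) (blank₀ 0) (proj₁ q))
        where blank₀ = column-blank xs empty
      check-conv (suc n) xs bound p rewrite heads≡column-zero xs = mk⇔
        (λ q → let (h₀ , h) = ∧-true q in h₀ , to (adjacent-tails xs) (to IH h))
        (λ (h₀ , h) → true-∧ h₀ (from IH (from (adjacent-tails xs) h)))
        where IH = check-conv n (tails xs) (maxLen-tails n xs bound) (just (column 0 xs))

    states : Finite (Maybe Column × Bool)
    states = finite-× (finite-Maybe (finite-Vec (finite-Maybe FG) r)) finite-Bool

  dfa : DFA Column
  dfa = dfaOn states (nothing , true) step final

  dfa-accepts : next blank blank ≡ true → ∀ xs → DFAAccepts dfa (conv xs) ⇔ Accepted xs
  dfa-accepts next-blank xs = mk⇔
    (λ a → to checks (proj₂ (∧-true (trans (sym (final-run nothing true (conv xs))) (to runs a)))))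
    (λ h → from runs (trans (final-run nothing true (conv xs)) (from checks h)))
    where
    runs = dfaOn-accepts states (nothing , true) step final (conv xs)
    checks = check-conv next-blank (maxLen xs) xs ≤-refl nothing

abstract
  universal : ∀ {A : Set} → DFA A
  universal = dfaOn finite-⊤ tt (λ _ _ → tt) (λ _ → true)

  universal-accepts : ∀ {A : Set} (u : List A) → DFAAccepts universal u
  universal-accepts u = from (dfaOn-accepts finite-⊤ tt (λ _ _ → tt) (λ _ → true) u) refl

module Relations {G : Set} (FG : Finite G) where

  abstract
    isTailOf : ∀ {r} → Fin r → AutRel G (suc r)
    isTailOf j = Window.dfa FG (λ _ → true) (λ a c → lookup a zero ≡ᵇ[ finite-Maybe FG ] lookup c (suc j))

    isTailOf-accepts : ∀ {r} (j : Fin r) y xs → InAutRel (isTailOf j) (y ∷ xs) ⇔ (y ≡ tailL (lookup xs j))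
    isTailOf-accepts {r} j y xs = mk⇔
      (λ a → !-ext y _ λ i → trans (≡ᵇ-sound FMG (proj₂ (to (W.dfa-accepts blank-ok (y ∷ xs)) a) i)) (shifted i))
      (λ { refl → from (W.dfa-accepts blank-ok (y ∷ xs))
                     (refl , λ i → subst (λ z → y ! i ≡ᵇ[ FMG ] z ≡ true) (sym (shifted i)) (≡ᵇ-refl FMG (y ! i))) })
      where
      FMG : Finite (Maybe G)
      FMG = finite-Maybe FG
      module W = Window FG (λ _ → true) (λ a c → lookup a zero ≡ᵇ[ FMG ] lookup c (suc j))
      blank-ok : lookup (blank {r = suc r}) zero ≡ᵇ[ FMG ] lookup blank (suc j) ≡ true
      blank-ok = subst (λ z → nothing ≡ᵇ[ FMG ] z ≡ true) (sym (lookup-replicate j nothing)) (≡ᵇ-refl FMG nothing)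
      shifted : ∀ i → lookup (column (suc i) xs) j ≡ tailL (lookup xs j) ! i
      shifted i = trans (lookup-column j (suc i) xs) (sym (!-tail (lookup xs j) i))

    isEmpty : ∀ {r} → Fin r → AutRel G r
    isEmpty j = Window.dfa FG (λ c → is-nothing (lookup c j)) (λ _ _ → true)

    isEmpty-accepts : ∀ {r} (j : Fin r) xs → InAutRel (isEmpty j) xs ⇔ (lookup xs j ≡ [])
    isEmpty-accepts j xs = mk⇔
      (λ a → empty (lookup xs j) (subst (λ z → is-nothing z ≡ true) (lookup-column j 0 xs) (proj₁ (to (W.dfa-accepts refl xs) a))))
      (λ e → from (W.dfa-accepts refl xs)
               (subst (λ z → is-nothing z ≡ true) (sym (trans (lookup-column j 0 xs) (cong (_! 0) e))) refl , λ _ → refl))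
      where
      module W = Window FG (λ c → is-nothing (lookup c j)) (λ _ _ → true)
      empty : ∀ (u : List G) → is-nothing (u ! 0) ≡ true → u ≡ []
      empty [] _ = refl

-- Runs of an NTM as strings

-- A configuration of width m is written as m letters; the cell under the head
-- also records the state and the move the machine is about to make.  In the
-- string of a run, rule a b c is the letter one period after b, without its move.

module Encoding {s : ℕ} (M : NTM s) where
  open NTM M

  TapeSym : Set
  TapeSym = TSym M

  State : Set
  State = Fin nQ

  Move : Set
  Move = State × TapeSym × Dir

  Letter : Set
  Letter = ⊤ ⊎ (TapeSym × Maybe (State × Move))

  Letter⁻ : Set
  Letter⁻ = ⊤ ⊎ (TapeSym × Maybe State)

  pattern sep = inj₁ tt
  pattern cell t h = inj₂ (t , h)

  forgetMove : Letter → Letter⁻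
  forgetMove sep                    = sep
  forgetMove (cell t nothing)       = cell t nothing
  forgetMove (cell t (just (q , _))) = cell t (just q)

  plain : TapeSym → Letter
  plain t = cell t nothing

  plain⁻ : TapeSym → Letter⁻
  plain⁻ t = cell t nothing

  head : State → TapeSym → Move → Letter
  head q t mv = cell t (just (q , mv))

  head⁻ : State → TapeSym → Letter⁻
  head⁻ q t = cell t (just q)

  leavesRight : Letter → Maybe State
  leavesRight (cell _ (just (_ , q , _ , right))) = just q
  leavesRight _                                   = nothing

  leavesLeft : Letter → Maybe State
  leavesLeft (cell _ (just (_ , q , _ , left))) = just q
  leavesLeft _                                  = nothing

  isSep : Letter → Bool
  isSep sep        = true
  isSep (cell _ _) = false

  arrival : Maybe State → Maybe State → TapeSym → Maybe Letter⁻
  arrival (just q) _        t = just (head⁻ q t)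
  arrival nothing  (just q) t = just (head⁻ q t)
  arrival nothing  nothing  t = just (plain⁻ t)

  -- nothing: the window is inconsistent with δ (or the head leaves the frame to the right)
  rule : Letter → Letter → Letter → Maybe Letter⁻
  rule a sep c = just sep
  rule a (cell t (just (q , q′ , b , left))) c =
    if δ q t q′ b left then (if isSep a then just (head⁻ q′ b) else just (plain⁻ b)) else nothing
  rule a (cell t (just (q , q′ , b , right))) c =
    if δ q t q′ b right then (if isSep c then nothing else just (plain⁻ b)) else nothing
  rule a (cell t nothing) c = arrival (leavesRight a) (leavesLeft c) t

  headOr : List Letter → Letter → Letter
  headOr [] r = r
  headOr (x ∷ _) r = x

  lastOr : List Letter → Letter → Letter
  lastOr [] a = a
  lastOr (x ∷ xs) a = lastOr xs x

  ruleAlong : Letter → List Letter → Letter → List (Maybe Letter⁻)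
  ruleAlong a [] r = []
  ruleAlong a (b ∷ t) r = rule a b (headOr t r) ∷ ruleAlong b t r

  headOr-++ : ∀ xs ys r → headOr (xs ++ ys) r ≡ headOr xs (headOr ys r)
  headOr-++ [] ys r = refl
  headOr-++ (x ∷ xs) ys r = refl

  ruleAlong-++ : ∀ a xs ys r → ruleAlong a (xs ++ ys) r ≡ ruleAlong a xs (headOr ys r) ++ ruleAlong (lastOr xs a) ys r
  ruleAlong-++ a [] ys r = refl
  ruleAlong-++ a (x ∷ xs) ys r = cong₂ _∷_ (cong (rule a x) (headOr-++ xs ys r)) (ruleAlong-++ x xs ys r)

  justPlain : TapeSym → Maybe Letter⁻
  justPlain t = just (plain⁻ t)

  ruleAlong-plain : ∀ a ts r → leavesRight a ≡ nothing → leavesLeft r ≡ nothing → ruleAlong a (map plain ts) r ≡ map justPlain ts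
  ruleAlong-plain a [] r p q = refl
  ruleAlong-plain a (t ∷ ts) r p q =
    cong₂ _∷_ (rule-plain a t (headOr (map plain ts) r) p (leavesLeft-headOr ts q)) (ruleAlong-plain (plain t) ts r refl q)
    where
    leavesLeft-headOr : ∀ ts {r} → leavesLeft r ≡ nothing → leavesLeft (headOr (map plain ts) r) ≡ nothing
    leavesLeft-headOr []      q = q
    leavesLeft-headOr (_ ∷ _) q = refl
    rule-plain : ∀ a t c → leavesRight a ≡ nothing → leavesLeft c ≡ nothing → rule a (plain t) c ≡ justPlain t
    rule-plain a t c p q rewrite p | q = refl

  leavesRight-lastOr : ∀ a ts → leavesRight a ≡ nothing → leavesRight (lastOr (map plain ts) a) ≡ nothing
  leavesRight-lastOr a [] p = p
  leavesRight-lastOr a (t ∷ ts) p = leavesRight-lastOr (plain t) ts refl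

  record Frame : Set where
    constructor frame
    field
      state   : State
      before  : List TapeSym  -- nearest cell first
      scanned : TapeSym
      after   : List TapeSym

  encode : Frame → Move → List Letter
  encode (frame q ls a T) mv = map plain (reverse ls) ++ head q a mv ∷ map plain T

  encode⁻ : Frame → List Letter⁻
  encode⁻ (frame q ls a T) = map plain⁻ (reverse ls) ++ head⁻ q a ∷ map plain⁻ T

  moveLeft : List TapeSym → List TapeSym → State → TapeSym → Maybe Frame
  moveLeft [] T q′ b = just (frame q′ [] b T)
  moveLeft (x ∷ ls) T q′ b = just (frame q′ ls x (b ∷ T))

  moveRight : List TapeSym → List TapeSym → State → TapeSym → Maybe Frame
  moveRight ls [] q′ b = nothing
  moveRight ls (y ∷ T) q′ b = just (frame q′ (b ∷ ls) y T)

  move : Frame → Move → Maybe Frame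
  move (frame q ls a T) (q′ , b , left) = moveLeft ls T q′ b
  move (frame q ls a T) (q′ , b , right) = moveRight ls T q′ b

  allowed : Frame → Move → Bool
  allowed (frame q ls a T) (q′ , b , d) = δ q a q′ b d

  map-reverse-∷ : ∀ {B : Set} (f : TapeSym → B) ls b (zs : List B) →
                  map f (reverse (b ∷ ls)) ++ zs ≡ map f (reverse ls) ++ f b ∷ zs
  map-reverse-∷ f ls b zs rewrite unfold-reverse b ls | map-++ f (reverse ls) [ b ] =
    ++-assoc (map f (reverse ls)) [ f b ] zs

  justs : List Letter⁻ → List (Maybe Letter⁻)
  justs = map just

  justs-plain-++ : ∀ xs ys → justs (map plain⁻ xs ++ ys) ≡ map justPlain xs ++ justs ys
  justs-plain-++ xs ys = trans (map-++ just (map plain⁻ xs) ys) (cong (_++ justs ys) (sym (map-∘ xs)))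

  ruleAlong-encode : ∀ f mv f′ → allowed f mv ≡ true → move f mv ≡ just f′ →
          ruleAlong sep (encode f mv) sep ≡ justs (encode⁻ f′)
  ruleAlong-encode (frame q [] a T) (q′ , b , left) .(frame q′ [] b T) v refl
    rewrite v = cong (just (head⁻ q′ b) ∷_) (trans (ruleAlong-plain (head q a (q′ , b , left)) T sep refl refl) (map-∘ T))
  ruleAlong-encode (frame q (x ∷ ls) a T) (q′ , b , left) .(frame q′ ls x (b ∷ T)) v refl =
    begin
      ruleAlong sep (map plain (reverse (x ∷ ls)) ++ head q a mv ∷ map plain T) sep
    ≡⟨ cong (λ z → ruleAlong sep z sep) (map-reverse-∷ plain ls x (head q a mv ∷ map plain T)) ⟩
      ruleAlong sep (map plain (reverse ls) ++ plain x ∷ head q a mv ∷ map plain T) sep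
    ≡⟨ ruleAlong-++ sep (map plain (reverse ls)) (plain x ∷ head q a mv ∷ map plain T) sep ⟩
      ruleAlong sep (map plain (reverse ls)) (plain x) ++ ruleAlong (lastOr (map plain (reverse ls)) sep) (plain x ∷ head q a mv ∷ map plain T) sep
    ≡⟨ cong₂ _++_ (ruleAlong-plain sep (reverse ls) (plain x) refl refl) (rest (lastOr (map plain (reverse ls)) sep) (leavesRight-lastOr sep (reverse ls) refl)) ⟩
      map justPlain (reverse ls) ++ just (head⁻ q′ x) ∷ just (plain⁻ b) ∷ map justPlain T
    ≡⟨ cong (λ z → map justPlain (reverse ls) ++ just (head⁻ q′ x) ∷ just (plain⁻ b) ∷ z) (map-∘ T) ⟩
      map justPlain (reverse ls) ++ justs (head⁻ q′ x ∷ plain⁻ b ∷ map plain⁻ T)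
    ≡⟨ sym (justs-plain-++ (reverse ls) (head⁻ q′ x ∷ plain⁻ b ∷ map plain⁻ T)) ⟩
      justs (map plain⁻ (reverse ls) ++ head⁻ q′ x ∷ plain⁻ b ∷ map plain⁻ T)
    ∎
    where
    open ≡-Reasoning
    mv = (q′ , b , left)
    rest : ∀ ℓ → leavesRight ℓ ≡ nothing → ruleAlong ℓ (plain x ∷ head q a mv ∷ map plain T) sep ≡ just (head⁻ q′ x) ∷ just (plain⁻ b) ∷ map justPlain T
    rest ℓ p rewrite p | v = cong (λ z → just (head⁻ q′ x) ∷ just (plain⁻ b) ∷ z) (ruleAlong-plain (head q a mv) T sep refl refl)
  ruleAlong-encode (frame q ls a (y ∷ T)) (q′ , b , right) .(frame q′ (b ∷ ls) y T) v refl =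
    begin
      ruleAlong sep (map plain (reverse ls) ++ head q a mv ∷ plain y ∷ map plain T) sep
    ≡⟨ ruleAlong-++ sep (map plain (reverse ls)) (head q a mv ∷ plain y ∷ map plain T) sep ⟩
      ruleAlong sep (map plain (reverse ls)) (head q a mv) ++ ruleAlong (lastOr (map plain (reverse ls)) sep) (head q a mv ∷ plain y ∷ map plain T) sep
    ≡⟨ cong₂ _++_ (ruleAlong-plain sep (reverse ls) (head q a mv) refl refl) (rest (lastOr (map plain (reverse ls)) sep)) ⟩
      map justPlain (reverse ls) ++ just (plain⁻ b) ∷ just (head⁻ q′ y) ∷ map justPlain T
    ≡⟨ sym (map-reverse-∷ justPlain ls b (just (head⁻ q′ y) ∷ map justPlain T)) ⟩
      map justPlain (reverse (b ∷ ls)) ++ just (head⁻ q′ y) ∷ map justPlain T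
    ≡⟨ cong (λ z → map justPlain (reverse (b ∷ ls)) ++ just (head⁻ q′ y) ∷ z) (map-∘ T) ⟩
      map justPlain (reverse (b ∷ ls)) ++ justs (head⁻ q′ y ∷ map plain⁻ T)
    ≡⟨ sym (justs-plain-++ (reverse (b ∷ ls)) (head⁻ q′ y ∷ map plain⁻ T)) ⟩
      justs (map plain⁻ (reverse (b ∷ ls)) ++ head⁻ q′ y ∷ map plain⁻ T)
    ∎
    where
    open ≡-Reasoning
    mv = (q′ , b , right)
    rest : ∀ ℓ → ruleAlong ℓ (head q a mv ∷ plain y ∷ map plain T) sep ≡ just (plain⁻ b) ∷ just (head⁻ q′ y) ∷ map justPlain T
    rest ℓ rewrite v = cong (λ z → just (plain⁻ b) ∷ just (head⁻ q′ y) ∷ z) (ruleAlong-plain (plain y) T sep refl refl)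

  length-ruleAlong : ∀ a xs r → length (ruleAlong a xs r) ≡ length xs
  length-ruleAlong a [] r = refl
  length-ruleAlong a (x ∷ xs) r = cong suc (length-ruleAlong x xs r)

  justs-! : ∀ X n v → justs X ! n ≡ just v → ∃ λ w → v ≡ just w
  justs-! [] n v ()
  justs-! (x ∷ X) zero .(just x) refl = x , refl
  justs-! (x ∷ X) (suc n) v p = justs-! X n v p

  ruleAlong-at-head : ∀ q ls a T mv → ruleAlong sep (encode (frame q ls a T) mv) sep ! length (map plain (reverse ls))
            ≡ just (rule (lastOr (map plain (reverse ls)) sep) (head q a mv) (headOr (map plain T) sep))
  ruleAlong-at-head q ls a T mv rewrite ruleAlong-++ sep (map plain (reverse ls)) (head q a mv ∷ map plain T) sep
    | sym (length-ruleAlong sep (map plain (reverse ls)) (head q a mv)) =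
    !-++ʳ (ruleAlong sep (map plain (reverse ls)) (head q a mv)) _ 0 (sym (+-identityʳ _))

  rule-at-head⇒allowed : ∀ ℓ q ls a T mv w → rule ℓ (head q a mv) (headOr (map plain T) sep) ≡ just w →
           allowed (frame q ls a T) mv ≡ true × (∃ λ f′ → move (frame q ls a T) mv ≡ just f′)
  rule-at-head⇒allowed ℓ q ls a T (q′ , b , left) w p with δ q a q′ b left
  rule-at-head⇒allowed ℓ q [] a T (q′ , b , left) w p | true = refl , _ , refl
  rule-at-head⇒allowed ℓ q (x ∷ ls) a T (q′ , b , left) w p | true = refl , _ , refl
  rule-at-head⇒allowed ℓ q ls a T (q′ , b , left) w () | false
  rule-at-head⇒allowed ℓ q ls a [] (q′ , b , right) w p with δ q a q′ b right
  rule-at-head⇒allowed ℓ q ls a [] (q′ , b , right) w () | true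
  rule-at-head⇒allowed ℓ q ls a [] (q′ , b , right) w () | false
  rule-at-head⇒allowed ℓ q ls a (y ∷ T) (q′ , b , right) w p with δ q a q′ b right
  rule-at-head⇒allowed ℓ q ls a (y ∷ T) (q′ , b , right) w p | true = refl , _ , refl
  rule-at-head⇒allowed ℓ q ls a (y ∷ T) (q′ , b , right) w () | false

  ruleAlong-encode⁻¹ : ∀ f mv X → ruleAlong sep (encode f mv) sep ≡ justs X →
          allowed f mv ≡ true × (∃ λ f′ → move f mv ≡ just f′ × X ≡ encode⁻ f′)
  ruleAlong-encode⁻¹ (frame q ls a T) mv X p
    with w , e ← justs-! X _ _ (trans (sym (cong (_! length (map plain (reverse ls))) p)) (ruleAlong-at-head q ls a T mv))
    with ok , f′ , moved ← rule-at-head⇒allowed _ q ls a T mv w e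
    = ok , f′ , moved , map-injective just-injective (trans (sym p) (ruleAlong-encode (frame q ls a T) mv f′ ok moved))

  ruleAlong-window : ∀ a xs r j → j < length xs → ∃ λ u → ∃ λ v → ∃ λ w →
    (a ∷ xs ++ r ∷ []) ! j ≡ just u × (a ∷ xs ++ r ∷ []) ! suc j ≡ just v ×
    (a ∷ xs ++ r ∷ []) ! suc (suc j) ≡ just w × ruleAlong a xs r ! j ≡ just (rule u v w)
  ruleAlong-window a (x ∷ []) r zero p = a , x , r , refl , refl , refl , refl
  ruleAlong-window a (x ∷ y ∷ xs) r zero p = a , x , y , refl , refl , refl , refl
  ruleAlong-window a (x ∷ xs) r (suc j) (s≤s p) = ruleAlong-window x xs r j p

  IsCell : Letter → Set
  IsCell x = ∃ λ y → x ≡ inj₂ y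

  encode-cells : ∀ f mv → All IsCell (encode f mv)
  encode-cells (frame q ls a T) mv = ++⁺ (plain-cells (reverse ls)) ((_ , refl) ∷ plain-cells T)
    where
    plain-cells : ∀ ts → All IsCell (map plain ts)
    plain-cells ts = map⁺ (All.universal (λ t → (t , nothing) , refl) ts)

  rule-cell≢sep : ∀ a y c → rule a (inj₂ y) c ≢ just sep
  rule-cell≢sep a (t , nothing) c e with leavesRight a | leavesLeft c
  rule-cell≢sep a (t , nothing) c () | just _ | _
  rule-cell≢sep a (t , nothing) c () | nothing | just _
  rule-cell≢sep a (t , nothing) c () | nothing | nothing
  rule-cell≢sep a (t , just (q , q′ , b , left)) c e with δ q t q′ b left | isSep a
  rule-cell≢sep a (t , just (q , q′ , b , left)) c () | true | true
  rule-cell≢sep a (t , just (q , q′ , b , left)) c () | true | false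
  rule-cell≢sep a (t , just (q , q′ , b , left)) c () | false | _
  rule-cell≢sep a (t , just (q , q′ , b , right)) c e with δ q t q′ b right | isSep c
  rule-cell≢sep a (t , just (q , q′ , b , right)) c () | true | true
  rule-cell≢sep a (t , just (q , q′ , b , right)) c () | true | false
  rule-cell≢sep a (t , just (q , q′ , b , right)) c () | false | _

  forgetMove≡sep : ∀ z → forgetMove z ≡ sep → z ≡ sep
  forgetMove≡sep sep                _  = refl
  forgetMove≡sep (cell t nothing)   ()
  forgetMove≡sep (cell t (just _)) ()

  forgetMove-plain : ∀ B ts → map forgetMove B ≡ map plain⁻ ts → B ≡ map plain ts
  forgetMove-plain [] [] _ = refl
  forgetMove-plain (cell t nothing ∷ B) (t′ ∷ ts) e with ∷-injective e
  ... | refl , e2 = cong (plain t ∷_) (forgetMove-plain B ts e2)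
  forgetMove-plain (sep ∷ B) (t′ ∷ ts) ()
  forgetMove-plain (cell t (just _) ∷ B) (t′ ∷ ts) ()

  forgetMove-frame : ∀ B xs q a ys → map forgetMove B ≡ map plain⁻ xs ++ head⁻ q a ∷ map plain⁻ ys →
            ∃ λ mv → B ≡ map plain xs ++ head q a mv ∷ map plain ys
  forgetMove-frame (cell t (just (_ , mv)) ∷ B) [] q a ys e with ∷-injective e
  ... | refl , e2 = mv , cong (head q a mv ∷_) (forgetMove-plain B ys e2)
  forgetMove-frame (sep ∷ B) [] q a ys ()
  forgetMove-frame (cell t nothing ∷ B) [] q a ys ()
  forgetMove-frame (cell t nothing ∷ B) (x ∷ xs) q a ys e with ∷-injective e
  ... | refl , e2 with forgetMove-frame B xs q a ys e2
  ... | mv , e3 = mv , cong (plain t ∷_) e3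
  forgetMove-frame (sep ∷ B) (x ∷ xs) q a ys ()
  forgetMove-frame (cell t (just _) ∷ B) (x ∷ xs) q a ys ()

  !-head : ∀ q ls a T mv X → (sep ∷ encode (frame q ls a T) mv ++ X) ! suc (length (map plain (reverse ls))) ≡ just (head q a mv)
  !-head q ls a T mv X rewrite ++-assoc (map plain (reverse ls)) (head q a mv ∷ map plain T) X =
    !-++ʳ (map plain (reverse ls)) (head q a mv ∷ map plain T ++ X) 0 (sym (+-identityʳ _))

  map-forgetMove-encode : ∀ f mv → map forgetMove (encode f mv) ≡ encode⁻ f
  map-forgetMove-encode (frame q ls a T) mv =
    trans (map-++ forgetMove (map plain (reverse ls)) _) (cong₂ _++_ (sym (map-∘ (reverse ls))) (cong (head⁻ q a ∷_) (sym (map-∘ T))))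

  encode-head-state : ∀ f mv {i q t mv′} → encode f mv ! i ≡ just (head q t mv′) → q ≡ Frame.state f
  encode-head-state (frame q ls a T) mv e = !-All heads e refl
    where
    HasState : Letter → Set
    HasState x = ∀ {q′ t mv′} → x ≡ head q′ t mv′ → q′ ≡ q
    plains : ∀ ts → All HasState (map plain ts)
    plains ts = map⁺ (All.universal (λ _ ()) ts)
    heads : All HasState (encode (frame q ls a T) mv)
    heads = ++⁺ (plains (reverse ls)) ((λ { refl → refl }) ∷ plains T)

m∸n≡1+k⇒m∸1+n≡k : ∀ m n k → m ∸ n ≡ suc k → m ∸ suc n ≡ k × suc n ≤ m
m∸n≡1+k⇒m∸1+n≡k (suc m) zero k refl = refl , s≤s z≤n
m∸n≡1+k⇒m∸1+n≡k (suc m) (suc n) k p with m∸n≡1+k⇒m∸1+n≡k m n k p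
... | a , b = a , s≤s b

m∸n≡1+m∸1+n : ∀ m n → suc n ≤ m → m ∸ n ≡ suc (m ∸ suc n)
m∸n≡1+m∸1+n (suc m) zero _ = refl
m∸n≡1+m∸1+n (suc m) (suc n) (s≤s p) = m∸n≡1+m∸1+n m n p

module Frames {s : ℕ} (M : NTM s) where
  open NTM M
  open Encoding M

  frameOf : ℕ → TConfig M → Frame
  frameOf m (tc q ls a rs) = frame q ls a (rs ++ replicate (m ∸ space M (tc q ls a rs)) nothing)

  frameOf-state : ∀ m c → Frame.state (frameOf m c) ≡ TConfig.st c
  frameOf-state m (tc q ls a rs) = refl

  space-shift : ∀ (x : TapeSym) ls rs → length (x ∷ ls) + suc (length rs) ≡ length ls + suc (length (x ∷ rs))
  space-shift x ls rs = sym (+-suc (length ls) (suc (length rs)))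

  step⇒move : ∀ m c c′ → TStep M c c′ → space M c′ ≤ m →
          ∃ λ mv → allowed (frameOf m c) mv ≡ true × move (frameOf m c) mv ≡ just (frameOf m c′)
  step⇒move m (tc p (x ∷ ls) a rs) (tc p′ .ls .x (b ∷ .rs)) (mvL {b = b} d) _ =
    (p′ , b , left) , d , cong (λ z → just (frame p′ ls x (b ∷ rs ++ replicate (m ∸ z) nothing))) (space-shift x ls rs)
  step⇒move m (tc p [] a rs) (tc p′ [] b .rs) (mvL₀ d) _ = (p′ , b , left) , d , refl
  step⇒move m (tc p ls a (x ∷ rs)) (tc p′ (b ∷ .ls) .x .rs) (mvR d) _ =
    (p′ , b , right) , d , cong (λ z → just (frame p′ (b ∷ ls) x (rs ++ replicate (m ∸ z) nothing))) (sym (space-shift b ls rs))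
  step⇒move m (tc p ls a []) (tc p′ (b ∷ .ls) nothing []) (mvR₀ d) sp
    rewrite m∸n≡1+m∸1+n m (length ls + 1) sp
    = (p′ , b , right) , d , refl

  move⇒step : ∀ m c mv f′ → allowed (frameOf m c) mv ≡ true → move (frameOf m c) mv ≡ just f′ →
           ∃ λ c′ → TStep M c c′ × f′ ≡ frameOf m c′ × (space M c ≤ m → space M c′ ≤ m)
  move⇒step m (tc p [] a rs) (p′ , b , left) f′ d refl = tc p′ [] b rs , mvL₀ d , refl , λ z → z
  move⇒step m (tc p (x ∷ ls) a rs) (p′ , b , left) f′ d refl =
    tc p′ ls x (b ∷ rs) , mvL d , cong (λ z → frame p′ ls x (b ∷ rs ++ replicate (m ∸ z) nothing)) (space-shift x ls rs)
    , λ z → subst (_≤ m) (space-shift x ls rs) z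
  move⇒step m (tc p ls a (x ∷ rs)) (p′ , b , right) f′ d refl =
    tc p′ (b ∷ ls) x rs , mvR d , cong (λ z → frame p′ (b ∷ ls) x (rs ++ replicate (m ∸ z) nothing)) (sym (space-shift b ls rs))
    , λ z → subst (_≤ m) (sym (space-shift b ls rs)) z
  move⇒step m (tc p ls a []) (p′ , b , right) f′ d e with m ∸ (length ls + 1) in eq
  move⇒step m (tc p ls a []) (p′ , b , right) f′ d () | zero
  move⇒step m (tc p ls a []) (p′ , b , right) f′ d refl | suc k with m∸n≡1+k⇒m∸1+n≡k m (length ls + 1) k eq
  ... | padding , fits =
    tc p′ (b ∷ ls) nothing [] , mvR₀ d ,
    cong (λ z → frame p′ (b ∷ ls) nothing (replicate z nothing)) (sym padding) ,
    λ _ → fits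

  space-tInit : ∀ v {m} → 1 ≤ m → length v ≤ m → space M (tInit M v) ≤ m
  space-tInit []      1≤m _  = 1≤m
  space-tInit (a ∷ v) {m} _ lv = subst (_≤ m) (cong suc (sym (length-map _ v))) lv

  space-step : ∀ {c c′} → TStep M c c′ → space M c ≤ space M c′
  space-step {tc _ (x ∷ ls) _ rs} (mvL _) = ≤-reflexive (space-shift x ls rs)
  space-step (mvL₀ _) = ≤-refl
  space-step {tc _ ls _ (x ∷ rs)} {tc _ (b ∷ _) _ _} (mvR _) = ≤-reflexive (sym (space-shift b ls rs))
  space-step {tc _ ls _ []} (mvR₀ _) = n≤1+n _

  space-run : ∀ {c c′} → Star (TStep M) c c′ → space M c ≤ space M c′
  space-run ε = ≤-refl
  space-run (x ◅ r) = ≤-trans (space-step x) (space-run r)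

  length-encode : ∀ {m} c mv → space M c ≤ m → length (encode (frameOf m c) mv) ≡ m
  length-encode {m} (tc q ls a rs) mv sp =
    begin
      length (map plain (reverse ls) ++ head q a mv ∷ map plain (rs ++ replicate kk nothing))
    ≡⟨ length-++ (map plain (reverse ls)) ⟩
      length (map plain (reverse ls)) + suc (length (map plain (rs ++ replicate kk nothing)))
    ≡⟨ cong₂ (λ u v → u + suc v) (trans (length-map plain (reverse ls)) (length-reverse ls))
         (trans (length-map plain (rs ++ replicate kk nothing)) (trans (length-++ rs) (cong (length rs +_) (length-replicate kk)))) ⟩
      length ls + suc (length rs + kk)
    ≡⟨ sym (+-assoc (length ls) (suc (length rs)) kk) ⟩
      (length ls + suc (length rs)) + kk
    ≡⟨ +-comm (length ls + suc (length rs)) kk ⟩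
      kk + (length ls + suc (length rs))
    ≡⟨ m∸n+n≡m sp ⟩
      m
    ∎
    where
    open ≡-Reasoning
    kk = m ∸ (length ls + suc (length rs))

  forgetMove-encode : ∀ {m} c′ B′ → map forgetMove B′ ≡ encode⁻ (frameOf m c′) → ∃ λ mv′ → B′ ≡ encode (frameOf m c′) mv′
  forgetMove-encode (tc q ls a rs) B′ e = forgetMove-frame B′ (reverse ls) q a _ e


module Histories {s : ℕ} (M : NTM s) (m : ℕ) where
  open NTM M
  open Encoding M
  open Frames M

  period : ℕ
  period = suc (suc m)

  RuleWindow : List Letter → ℕ → Letter → Set
  RuleWindow L j z = ∃ λ a → ∃ λ b → ∃ λ c →
    L ! j ≡ just a × L ! suc j ≡ just b × L ! suc (suc j) ≡ just c × rule a b c ≡ just (forgetMove z)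

  FollowsRule : List Letter → Set
  FollowsRule L = ∀ j z → L ! (period + j) ≡ just z → RuleWindow L j z

  EndsWithSep : List Letter → Set
  EndsWithSep L = ∀ j x → L ! j ≡ just x → L ! suc j ≡ nothing → x ≡ sep

  HaltsAccepting : List Letter → Set
  HaltsAccepting L = ∀ j q t mv → L ! suc j ≡ just (head q t mv) → L ! (period + j) ≡ nothing → accQ q ≡ true

  infixr 5 ⟪_⟫_
  ⟪_⟫_ : List Letter → List Letter → List Letter
  ⟪ B ⟫ R = sep ∷ B ++ sep ∷ R

  record Valid (L : List Letter) : Set where
    field
      followsRule    : FollowsRule L
      endsWithSep    : EndsWithSep L
      haltsAccepting : HaltsAccepting L
  open Valid

  module _ (P L′ : List Letter) where
    !-after : ∀ j → (P ++ L′) ! (length P + j) ≡ L′ ! j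
    !-after j = !-++ʳ P L′ j refl
    !-after-suc : ∀ j → (P ++ L′) ! suc (length P + j) ≡ L′ ! suc j
    !-after-suc j = !-++ʳ P L′ (suc j) (sym (+-suc (length P) j))
    !-after-suc² : ∀ j → (P ++ L′) ! suc (suc (length P + j)) ≡ L′ ! suc (suc j)
    !-after-suc² j = !-++ʳ P L′ (suc (suc j)) (trans (cong suc (sym (+-suc (length P) j))) (sym (+-suc (length P) (suc j))))
    !-after-period : ∀ j → (P ++ L′) ! (period + (length P + j)) ≡ L′ ! (period + j)
    !-after-period j = !-++ʳ P L′ (period + j) (x∙yz≈y∙xz period (length P) j)
    FollowsRule-drop : FollowsRule (P ++ L′) → FollowsRule L′
    FollowsRule-drop h j z e with h (length P + j) z (trans (!-after-period j) e)
    ... | a , b , c , e1 , e2 , e3 , e4 = a , b , c , trans (sym (!-after j)) e1 , trans (sym (!-after-suc j)) e2 , trans (sym (!-after-suc² j)) e3 , e4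

    EndsWithSep-drop : EndsWithSep (P ++ L′) → EndsWithSep L′
    EndsWithSep-drop h j x e1 e2 = h (length P + j) x (trans (!-after j) e1) (trans (!-after-suc j) e2)

    HaltsAccepting-drop : HaltsAccepting (P ++ L′) → HaltsAccepting L′
    HaltsAccepting-drop h j q t mv e1 e2 = h (length P + j) q t mv (trans (!-after-suc j) e1) (trans (!-after-period j) e2)

    Valid-drop : Valid (P ++ L′) → Valid L′
    Valid-drop v = record { followsRule = FollowsRule-drop (followsRule v) ; endsWithSep = EndsWithSep-drop (endsWithSep v)
                          ; haltsAccepting = HaltsAccepting-drop (haltsAccepting v) }

  length-⟪⟫[] : ∀ B → length B ≡ m → length (⟪ B ⟫ []) ≡ period
  length-⟪⟫[] B lB = cong suc (trans (length-++ B) (trans (cong (_+ 1) lB) (+-comm m 1)))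

  module Block (B R : List Letter) (lB : length B ≡ m) where
    L : List Letter
    L = ⟪ B ⟫ R

    L-block : ∀ {i} → i < m → L ! suc i ≡ B ! i
    L-block i<m = !-++ˡ B (sep ∷ R) (subst (_ <_) (sym lB) i<m)

    L-sep : L ! suc m ≡ just sep
    L-sep = !-++ʳ B (sep ∷ R) 0 (trans (sym (+-identityʳ m)) (cong (_+ 0) (sym lB)))

    L-rest : ∀ j → L ! (period + j) ≡ R ! j
    L-rest j = !-++ʳ B (sep ∷ R) (suc j) (trans (sym (+-suc m j)) (cong (_+ suc j) (sym lB)))

    L-prefix : ∀ {j} → j < period → L ! j ≡ (⟪ B ⟫ []) ! j
    L-prefix {j} j<p = trans (cong (λ z → (sep ∷ z) ! j) (sym (++-assoc B (sep ∷ []) R)))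
                             (!-++ˡ (⟪ B ⟫ []) R (subst (j <_) (sym (length-⟪⟫[] B lB)) j<p))

    -- a cell is never mapped to a separator, so the separator closing the
    -- next block cannot come early
    rest-not-short : All IsCell B → FollowsRule L → EndsWithSep L → ∀ i {z} → R ! i ≡ just z → R ! suc i ≡ nothing → ¬ i < m
    rest-not-short cells rule-ok ends i {z} ez past i<m
      with a , b , c , _ , eb , _ , e ← rule-ok i z (trans (L-rest i) ez)
      with y , refl ← !-All cells (trans (sym (L-block i<m)) eb)
      = rule-cell≢sep a y c
          (trans e (cong (just ∘ forgetMove) (ends (period + i) z (trans (L-rest i) ez) (trans (L-rest′ i) past))))
      where
      L-rest′ : ∀ j → L ! suc (period + j) ≡ R ! suc j
      L-rest′ j = trans (cong (L !_) (sym (+-suc period j))) (L-rest (suc j))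

    rest-sep : FollowsRule L → ∀ {z} → R ! m ≡ just z → z ≡ sep
    rest-sep rule-ok {z} e with _ , _ , _ , _ , eb , _ , e′ ← rule-ok m z (trans (L-rest m) e)
      with refl ← trans (sym eb) L-sep
      = forgetMove≡sep z (sym (just-injective e′))

    ruleAlong-next : ∀ B′ → length B′ ≡ m → (∀ {j} → j < m → R ! j ≡ B′ ! j) → FollowsRule L →
                     ruleAlong sep B sep ≡ justs (map forgetMove B′)
    ruleAlong-next B′ lB′ R≡B′ rule-ok = !-ext< _ _ lengths pointwise
      where
      lengths : length (ruleAlong sep B sep) ≡ length (justs (map forgetMove B′))
      lengths = trans (length-ruleAlong sep B sep)
                      (trans lB (sym (trans (length-map just (map forgetMove B′)) (trans (length-map forgetMove B′) lB′))))
      pointwise : ∀ i → i < length (ruleAlong sep B sep) → ruleAlong sep B sep ! i ≡ justs (map forgetMove B′) ! i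
      pointwise i p
        with i<m ← subst (i <_) (trans (length-ruleAlong sep B sep) lB) p
        with u , v , w , eu , ev , ew , e ← ruleAlong-window sep B sep i (subst (i <_) (length-ruleAlong sep B sep) p)
        with z , ez ← !-< B′ (subst (i <_) (sym lB′) i<m)
        with a , b , c , ea , eb , ec , e′ ← rule-ok i z (trans (L-rest i) (trans (R≡B′ i<m) ez))
        = begin
            ruleAlong sep B sep ! i           ≡⟨ e ⟩
            just (rule u v w)                 ≡⟨ cong just (cong₃ rule (window ea eu lt₀) (window eb ev lt₁) (window ec ew lt₂)) ⟩
            just (rule a b c)                 ≡⟨ cong just e′ ⟩
            just (just (forgetMove z))        ≡˘⟨ cong (Maybe.map just) (trans (!-map forgetMove B′ i) (cong (Maybe.map forgetMove) ez)) ⟩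
            Maybe.map just (map forgetMove B′ ! i) ≡˘⟨ !-map just (map forgetMove B′) i ⟩
            justs (map forgetMove B′) ! i     ∎
        where
        open ≡-Reasoning
        window : ∀ {j x y} → L ! j ≡ just x → (⟪ B ⟫ []) ! j ≡ just y → j < period → y ≡ x
        window ex ey j<p = just-injective (trans (sym ey) (trans (sym (L-prefix j<p)) ex))
        lt₀ = ≤-trans (m≤n+m _ 2) (subst (_< period) refl (s≤s (s≤s i<m)))
        lt₁ = ≤-trans (m≤n+m _ 1) (s≤s (s≤s i<m))
        lt₂ = s≤s (s≤s i<m)

  NextBlock : TConfig M → List Letter → Set
  NextBlock c R = ∃ λ c′ → ∃ λ mv′ → ∃ λ R′ → TStep M c c′ × space M c′ ≤ m × R ≡ encode (frameOf m c′) mv′ ++ sep ∷ R′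

  module _ {c : TConfig M} {mv : Move} (sp : space M c ≤ m) where
    lB : length (encode (frameOf m c) mv) ≡ m
    lB = length-encode c mv sp

    open Block (encode (frameOf m c) mv)

    next-block : ∀ r R₀ → FollowsRule (⟪ encode (frameOf m c) mv ⟫ r ∷ R₀) →
                 EndsWithSep (⟪ encode (frameOf m c) mv ⟫ r ∷ R₀) → NextBlock c (r ∷ R₀)
    next-block r R₀ rule-ok ends = by-cases ((r ∷ R₀) ! m) refl
      where
      R = r ∷ R₀
      by-cases : ∀ x → R ! m ≡ x → NextBlock c R
      by-cases nothing e = ⊥-elim (too-short (!-last r R₀))
        where
        too-short : (∃ λ z → R ! length R₀ ≡ just z × R ! suc (length R₀) ≡ nothing) → ⊥
        too-short (z , ez , past) =
          rest-not-short R lB (encode-cells (frameOf m c) mv) rule-ok ends (length R₀) ez past (!-nothing⇒≥ R m e)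
      by-cases (just z) e = split (!-split R m (trans e (cong just (rest-sep R lB rule-ok e))))
        where
        split : (∃ λ B′ → ∃ λ R′ → R ≡ B′ ++ sep ∷ R′ × length B′ ≡ m) → NextBlock c R
        split (B′ , R′ , eR , lB′) = successor (ruleAlong-encode⁻¹ (frameOf m c) mv (map forgetMove B′) rules)
          where
          rules : ruleAlong sep (encode (frameOf m c) mv) sep ≡ justs (map forgetMove B′)
          rules = ruleAlong-next R lB B′ lB′ (λ j<m → trans (cong (_! _) eR) (!-++ˡ B′ (sep ∷ R′) (subst (_ <_) (sym lB′) j<m))) rule-ok
          successor : (allowed (frameOf m c) mv ≡ true × ∃ λ f′ → move (frameOf m c) mv ≡ just f′ × map forgetMove B′ ≡ encode⁻ f′) →
                      NextBlock c R
          successor (ok , f′ , moved , forgotten) = realise (move⇒step m c mv f′ ok moved)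
            where
            realise : (∃ λ c′ → TStep M c c′ × f′ ≡ frameOf m c′ × (space M c ≤ m → space M c′ ≤ m)) → NextBlock c R
            realise (c′ , step , f′≡ , sp-mono) = encoded (forgetMove-encode c′ B′ (trans forgotten (cong encode⁻ f′≡)))
              where
              encoded : (∃ λ mv′ → B′ ≡ encode (frameOf m c′) mv′) → NextBlock c R
              encoded (mv′ , B′≡) = c′ , mv′ , R′ , step , sp-mono sp , trans eR (cong (_++ sep ∷ R′) B′≡)

  last-block : ∀ c mv (sp : space M c ≤ m) → HaltsAccepting (⟪ encode (frameOf m c) mv ⟫ []) → Accepting M c
  last-block (tc q ls a rs) mv sp halts = halts p q a mv (!-head q ls a T mv (sep ∷ [])) (!-≥ (sep ∷ B ++ sep ∷ []) lenL)
    where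
    T = rs ++ replicate (m ∸ space M (tc q ls a rs)) nothing
    B = encode (frameOf m (tc q ls a rs)) mv
    p = length (map plain (reverse ls))
    lenL : length (sep ∷ B ++ sep ∷ []) ≤ period + p
    lenL = ≤-trans (≤-reflexive (length-⟪⟫[] B (length-encode (tc q ls a rs) mv sp))) (m≤m+n period p)

  sound : ∀ fuel c mv R (sp : space M c ≤ m) → length (⟪ encode (frameOf m c) mv ⟫ R) ≤ fuel →
          Valid (⟪ encode (frameOf m c) mv ⟫ R) → ∃ λ c′ → Star (TStep M) c c′ × Accepting M c′
  sound fuel       c mv []       sp len v = c , ε , last-block c mv sp (haltsAccepting v)
  sound (suc fuel) c mv (r ∷ R₀) sp len v
    with c′ , mv′ , R′ , step , sp′ , eR ← next-block sp r R₀ (followsRule v) (endsWithSep v)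
    with c″ , run , acc ← sound fuel c′ mv′ R′ sp′
           (s≤s⁻¹ (≤-trans (s≤s (suffix-shorter (encode (frameOf m c) mv) _))
                            (subst (λ X → length (⟪ encode (frameOf m c) mv ⟫ X) ≤ suc fuel) eR len)))
           (Valid-drop (sep ∷ encode (frameOf m c) mv) _
                       (subst (λ X → Valid (⟪ encode (frameOf m c) mv ⟫ X)) eR v))
    = c″ , step ◅ run , acc

module Completeness {s : ℕ} (M : NTM s) (m : ℕ) where
  open NTM M
  open Encoding M
  open Frames M
  open Histories M m

  moveOf : ∀ {c c′} → TStep M c c′ → space M c′ ≤ m → Move
  moveOf {c} {c′} step sp = proj₁ (step⇒move m c c′ step sp)

  -- The move recorded in the last configuration is arbitrary: no block follows it.
  blocks : ∀ {c c′} → Star (TStep M) c c′ → space M c′ ≤ m → List Letter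
  blocks {c} ε            sp = encode (frameOf m c) (TConfig.st c , nothing , left) ++ sep ∷ []
  blocks {c} (step ◅ run) sp = encode (frameOf m c) (moveOf step (≤-trans (space-run run) sp)) ++ sep ∷ blocks run sp

  history : ∀ {c c′} → Star (TStep M) c c′ → space M c′ ≤ m → List Letter
  history run sp = sep ∷ blocks run sp

  history-⟪⟫ : ∀ {c c′} (run : Star (TStep M) c c′) sp → ∃ λ mv → ∃ λ R → history run sp ≡ ⟪ encode (frameOf m c) mv ⟫ R
  history-⟪⟫ ε            sp = _ , [] , refl
  history-⟪⟫ (step ◅ run) sp = _ , blocks run sp , refl

  history-ends : ∀ {c c′} (run : Star (TStep M) c c′) sp → ∃ λ Pre → history run sp ≡ Pre ++ sep ∷ []
  history-ends {c} ε sp = sep ∷ encode (frameOf m c) _ , refl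
  history-ends {c} (step ◅ run) sp with Pre , e ← history-ends run sp =
    sep ∷ B ++ Pre , cong (sep ∷_) (trans (cong (B ++_) e) (sym (++-assoc B Pre (sep ∷ []))))
    where B = encode (frameOf m c) (moveOf step (≤-trans (space-run run) sp))

  EndsWithSep-snoc : ∀ Pre → EndsWithSep (Pre ++ sep ∷ [])
  EndsWithSep-snoc Pre j x e e′ = just-injective (trans (sym e) (!-++ʳ Pre (sep ∷ []) 0 (trans j≡ (sym (+-identityʳ _)))))
    where
    len : length (Pre ++ sep ∷ []) ≡ suc (length Pre)
    len = trans (length-++ Pre) (+-comm (length Pre) 1)
    j≡ : j ≡ length Pre
    j≡ = ≤-antisym (s≤s⁻¹ (subst (suc j ≤_) len (!-just⇒< (Pre ++ sep ∷ []) j e))) (s≤s⁻¹ (subst (_≤ suc j) len (!-nothing⇒≥ (Pre ++ sep ∷ []) (suc j) e′)))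

  FollowsRule-last : ∀ B → length B ≡ m → FollowsRule (⟪ B ⟫ [])
  FollowsRule-last B lB j z e = ⊥-elim (<⇒≱ (!-just⇒< (⟪ B ⟫ []) (period + j) e) (subst (_≤ period + j) (sym (length-⟪⟫[] B lB)) (m≤m+n period j)))

  HaltsAccepting-last : ∀ f mv → length (encode f mv) ≡ m → accQ (Frame.state f) ≡ true → HaltsAccepting (⟪ encode f mv ⟫ [])
  HaltsAccepting-last f mv lB acc j q t mv′ e _ with <-cmp j m
  ... | tri< j<m _ _ =
    subst (λ q → accQ q ≡ true) (sym (encode-head-state f mv (trans (sym (Block.L-block (encode f mv) [] lB j<m)) e))) acc
  ... | tri≈ _ refl _ with () ← trans (sym e) (Block.L-sep (encode f mv) [] lB)
  ... | tri> _ _ m<j with () ← trans (sym e) (!-≥ (⟪ encode f mv ⟫ []) (≤-trans (≤-reflexive (length-⟪⟫[] (encode f mv) lB)) (s≤s m<j)))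

  module _ (B B′ R′ : List Letter) (lB : length B ≡ m) (lB′ : length B′ ≡ m) where
    open Block B (B′ ++ sep ∷ R′) lB

    !-next : ∀ {i k} → i ≡ suc m + k → L ! i ≡ (⟪ B′ ⟫ R′) ! k
    !-next {i} {k} e = !-++ʳ (sep ∷ B) (⟪ B′ ⟫ R′) k (trans e (cong (λ n → suc n + k) (sym lB)))

    rest-long : suc m ≤ length (B′ ++ sep ∷ R′)
    rest-long = subst (suc m ≤_) (sym (trans (length-++ B′) (cong (_+ suc (length R′)) lB′)))
                      (≤-trans (s≤s (m≤m+n m (length R′))) (≤-reflexive (sym (+-suc m (length R′)))))

    next-block-long : ∀ j → j < suc m → ∃ λ x → L ! (period + j) ≡ just x
    next-block-long j j≤m with x , e ← !-< (B′ ++ sep ∷ R′) (≤-trans j≤m rest-long) = x , trans (L-rest j) e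

    FollowsRule-cons : ruleAlong sep B sep ≡ justs (map forgetMove B′) → FollowsRule (⟪ B′ ⟫ R′) → FollowsRule L
    FollowsRule-cons rules rule-ok j z e = by-cases (<-cmp j m)
      where
      ez : (B′ ++ sep ∷ R′) ! j ≡ just z
      ez = trans (sym (L-rest j)) e
      exists : ∀ i → i ≤ period + j → ∃ λ x → L ! i ≡ just x
      exists i i≤ = !-< L (<-≤-trans (s≤s i≤) (!-just⇒< L (period + j) e))
      by-cases : Tri (j < m) (j ≡ m) (m < j) → RuleWindow L j z
      by-cases (tri< j<m _ _)
        with u , v , w , eu , ev , ew , e′ ← ruleAlong-window sep B sep j (subst (j <_) (sym lB) j<m) =
        u , v , w , trans (L-prefix (m≤n⇒m≤1+n (m≤n⇒m≤1+n j<m))) eu , trans (L-prefix (s≤s (m≤n⇒m≤1+n j<m))) ev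
          , trans (L-prefix (s≤s (s≤s j<m))) ew
          , just-injective (trans (sym e′) (trans (cong (_! j) rules) (!-map-just just (map forgetMove B′) (!-map-just forgetMove B′ zB′))))
        where
        zB′ : B′ ! j ≡ just z
        zB′ = trans (sym (!-++ˡ B′ (sep ∷ R′) (subst (j <_) (sym lB′) j<m))) ez
      by-cases (tri≈ _ refl _) with a , ea ← exists m (≤-trans (m≤n+m m 2) (m≤m+n period m)) with c , ec ← exists (period) (m≤m+n period m) =
        a , sep , c , ea , L-sep , ec , cong (just ∘ forgetMove) (sym z≡sep)
        where
        z≡sep : z ≡ sep
        z≡sep = just-injective (trans (sym ez) (!-++ʳ B′ (sep ∷ R′) 0 (trans (sym (+-identityʳ m)) (cong (_+ 0) (sym lB′)))))
      by-cases (tri> _ _ m<j) with k , refl ← m≤n⇒∃[o]m+o≡n m<j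
        with a , b , c , ea , eb , ec , e′ ← rule-ok k z (trans (sym (!-next (x∙yz≈y∙xz period (suc m) k))) e) =
        a , b , c , trans (!-next refl) ea , trans (!-next (sym (+-suc (suc m) k))) eb
          , trans (!-next (sym (trans (+-suc (suc m) (suc k)) (cong suc (+-suc (suc m) k))))) ec , e′

    HaltsAccepting-cons : HaltsAccepting (⟪ B′ ⟫ R′) → HaltsAccepting L
    HaltsAccepting-cons halts j q t mv e e′ with <-cmp j m
    ... | tri< j<m _ _ with x , ex ← next-block-long j (m≤n⇒m≤1+n j<m) with () ← trans (sym e′) ex
    ... | tri≈ _ refl _ with () ← trans (sym e) L-sep
    ... | tri> _ _ m<j with k , refl ← m≤n⇒∃[o]m+o≡n m<j
      = halts k q t mv (trans (sym (!-next (sym (+-suc (suc m) k)))) e) (trans (sym (!-next (x∙yz≈y∙xz period (suc m) k))) e′)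

  history-valid : ∀ {c c′} (run : Star (TStep M) c c′) (sp : space M c′ ≤ m) → accQ (TConfig.st c′) ≡ true →
                  Valid (history run sp)
  history-valid run sp acc = record
    { followsRule = follows run ; endsWithSep = ends ; haltsAccepting = halts run }
    where
    ends : EndsWithSep (history run sp)
    ends with Pre , e ← history-ends run sp = subst EndsWithSep (sym e) (EndsWithSep-snoc Pre)
    follows : ∀ {c} (run : Star (TStep M) c _) → FollowsRule (history run sp)
    follows {c} ε = FollowsRule-last _ (length-encode c _ sp)
    follows {c} (_◅_ {j = c′} step run) with mv′ , R′ , e ← history-⟪⟫ run sp =
      subst (λ X → FollowsRule (sep ∷ B ++ X)) (sym e)
        (FollowsRule-cons B (encode (frameOf m c′) mv′) R′ (length-encode c mv (≤-trans (space-step step) sp′))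
           (length-encode c′ mv′ sp′) rules (subst FollowsRule e (follows run)))
      where
      sp′ = ≤-trans (space-run run) sp
      mv = moveOf step sp′
      B = encode (frameOf m c) mv
      moved = step⇒move m c c′ step sp′
      rules : ruleAlong sep B sep ≡ justs (map forgetMove (encode (frameOf m c′) mv′))
      rules = trans (ruleAlong-encode (frameOf m c) mv (frameOf m c′) (proj₁ (proj₂ moved)) (proj₂ (proj₂ moved)))
                    (cong justs (sym (map-forgetMove-encode (frameOf m c′) mv′)))
    halts : ∀ {c} (run : Star (TStep M) c _) → HaltsAccepting (history run sp)
    halts {c} ε = HaltsAccepting-last (frameOf m c) _ (length-encode c _ sp) (subst (λ q → accQ q ≡ true) (sym (frameOf-state m c)) acc)
    halts {c} (_◅_ {j = c′} step run) with mv′ , R′ , e ← history-⟪⟫ run sp =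
      subst (λ X → HaltsAccepting (sep ∷ B ++ X)) (sym e)
        (HaltsAccepting-cons B (encode (frameOf m c′) mv′) R′ (length-encode c mv (≤-trans (space-step step) sp′))
           (length-encode c′ mv′ sp′) (subst HaltsAccepting e (halts run)))
      where
      sp′ = ≤-trans (space-run run) sp
      mv = moveOf step sp′
      B = encode (frameOf m c) mv

module Steps {s : ℕ} (U : UNARM s) (w : List (Fin s)) where
  open UNARM U

  Continues : Fin (suc len) → RConfig U → Vec (Reg U) R → Set
  Continues pc c rs = ∃ λ pc′ → nextPc pc ≡ just pc′ × c ≡ ⟨ pc′ , rs ⟩

  Effect : Instr s k R (suc len) → Fin (suc len) → Vec (Reg U) R → RConfig U → Set
  Effect (iRead i)     pc rs c = Continues pc c (rs [ i ]≔ map inj₁ w)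
  Effect (iWrite _)    pc rs c = Continues pc c rs
  Effect (iConst i u)  pc rs c = Continues pc c (rs [ i ]≔ u)
  Effect (iCopy i j)   pc rs c = Continues pc c (rs [ i ]≔ lookup rs j)
  Effect (iAssign i D) pc rs c = ∃ λ y → InAutRel D (y ∷ rs) × Continues pc c (rs [ i ]≔ y)
  Effect (iGoto l)     pc rs c = c ≡ ⟨ l , rs ⟩
  Effect (iIfGoto D l) pc rs c = (InAutRel D rs × c ≡ ⟨ l , rs ⟩) ⊎ (¬ InAutRel D rs × Continues pc c rs)
  Effect iAccept       pc rs c = ⊥
  Effect iReject       pc rs c = ⊥

  step-effect : ∀ {pc rs c} → RStep U w ⟨ pc , rs ⟩ c → Effect (prog pc) pc rs c
  step-effect (sRead e n)       rewrite e = _ , n , refl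
  step-effect (sWrite e n)      rewrite e = _ , n , refl
  step-effect (sConst e n)      rewrite e = _ , n , refl
  step-effect (sCopy e n)       rewrite e = _ , n , refl
  step-effect (sAssign y e a n) rewrite e = y , a , _ , n , refl
  step-effect (sGoto e)         rewrite e = refl
  step-effect (sIfYes e a)      rewrite e = inj₁ (a , refl)
  step-effect (sIfNo e a n)     rewrite e = inj₂ (a , _ , n , refl)

  AcceptsWithin-step : ∀ {t pc rs} → prog pc ≢ iAccept → AcceptsWithin U w t ⟨ pc , rs ⟩ →
                       ∃ λ c → ∃ λ t′ → t ≡ suc t′ × RStep U w ⟨ pc , rs ⟩ c × AcceptsWithin U w t′ c
  AcceptsWithin-step ¬accept (here e)     = ⊥-elim (¬accept e)
  AcceptsWithin-step _       (there st a) = _ , _ , refl , st , a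

  AcceptsWithin-mono : ∀ {t t′ c} → t ≤ t′ → AcceptsWithin U w t c → AcceptsWithin U w t′ c
  AcceptsWithin-mono (s≤s _)   (here e)      = here e
  AcceptsWithin-mono (s≤s t≤t′) (there st a) = there st (AcceptsWithin-mono t≤t′ a)

-- The simulating register machine

infixr 5 _⇒ᵇ_
_⇒ᵇ_ : Bool → Bool → Bool
true  ⇒ᵇ b = b
false ⇒ᵇ b = true

⇒ᵇ-elim : ∀ {a b} → (a ⇒ᵇ b) ≡ true → a ≡ true → b ≡ true
⇒ᵇ-elim p refl = p

⇒ᵇ-intro : ∀ {a b} → (a ≡ true → b ≡ true) → (a ⇒ᵇ b) ≡ true
⇒ᵇ-intro {true}  f = f refl
⇒ᵇ-intro {false} f = refl

-- The machine reads w into W, guesses a history H and a counter C (its length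
-- is the period m + 2 of H), copies C to K and shifts K and H by one and two
-- letters into K₁, K₂, H₁, H₂.  A loop of |K| rounds turns Z := H into H
-- shifted by one period, so that column j of the final check sees the window
-- H[j], H[j+1], H[j+2] together with the letter Z[j] one period later.

module Machine {s : ℕ} (M : NTM s) where
  open NTM M
  open Encoding M
  open Relations

  finite-TapeSym : Finite TapeSym
  finite-TapeSym = finite-Maybe (finite-⊎ (finite-Fin s) (finite-Fin k))

  finite-State : Finite State
  finite-State = finite-Fin nQ

  finite-Letter : Finite Letter
  finite-Letter = finite-⊎ finite-⊤ (finite-× finite-TapeSym
                    (finite-Maybe (finite-× finite-State (finite-× finite-State (finite-× finite-TapeSym finite-Dir)))))

  finite-Letter⁻ : Finite (Maybe Letter⁻)
  finite-Letter⁻ = finite-Maybe (finite-⊎ finite-⊤ (finite-× finite-TapeSym (finite-Maybe finite-State)))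

  Γ : Set
  Γ = Γsym s (size finite-Letter)

  finite-Γ : Finite Γ
  finite-Γ = finite-⊎ (finite-Fin s) (finite-Fin (size finite-Letter))

  toΓ : Letter → Γ
  toΓ x = inj₂ (index finite-Letter x)

  -- input symbols never occur in a history; they are read as separators
  fromΓ : Γ → Letter
  fromΓ (inj₁ _) = sep
  fromΓ (inj₂ i) = element finite-Letter i

  fromΓ-toΓ : ∀ x → fromΓ (toΓ x) ≡ x
  fromΓ-toΓ = element-index finite-Letter

  letterAt : Maybe Γ → Maybe Letter
  letterAt = Maybe.map fromΓ

  inputAt : Maybe Γ → TapeSym
  inputAt (just (inj₁ a)) = just (inj₁ a)
  inputAt _               = nothing

  isSepᴹ : Maybe Letter → Bool
  isSepᴹ (just sep) = true
  isSepᴹ _          = false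

  startHead : Bool → Maybe (State × Move) → Bool
  startHead true  (just (q , _)) = q ≡ᵇ[ finite-State ] q₀
  startHead true  nothing        = false
  startHead false (just _)       = false
  startHead false nothing        = true

  startCell : Bool → Maybe Γ → Maybe Letter → Bool
  startCell isFirst a (just (cell t h)) = t ≡ᵇ[ finite-TapeSym ] inputAt a ∧ startHead isFirst h
  startCell _       _ _                 = false

  ruleHolds : Maybe Letter → Maybe Letter → Maybe Letter → Maybe Letter → Bool
  ruleHolds nothing  _        _        _        = true
  ruleHolds (just z) (just a) (just b) (just c) = rule a b c ≡ᵇ[ finite-Letter⁻ ] just (forgetMove z)
  ruleHolds (just _) _        _        _        = false

  haltHolds : Maybe Letter → Maybe Letter → Bool
  haltHolds (just (cell _ (just (q , _)))) z = is-just z ∨ accQ q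
  haltHolds _                              _ = true

  Column : Set
  Column = Vec (Maybe Γ) 9

  -- columns list, in this order, the registers W H Z C K K₁ K₂ H₁ H₂
  counterEnd inputFits historyEnd ruleAt haltAt everyColumn firstColumn laterColumn : Column → Bool
  counterEnd  (w ∷ h ∷ z ∷ c ∷ k ∷ k₁ ∷ k₂ ∷ h₁ ∷ h₂ ∷ []) = is-just k ∧ not (is-just k₁) ⇒ᵇ isSepᴹ (letterAt h)
  inputFits   (w ∷ h ∷ z ∷ c ∷ k ∷ k₁ ∷ k₂ ∷ h₁ ∷ h₂ ∷ []) = is-just w ⇒ᵇ is-just k₂
  historyEnd  (w ∷ h ∷ z ∷ c ∷ k ∷ k₁ ∷ k₂ ∷ h₁ ∷ h₂ ∷ []) = is-just (letterAt h) ∧ not (is-just (letterAt h₁)) ⇒ᵇ isSepᴹ (letterAt h)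
  ruleAt      (w ∷ h ∷ z ∷ c ∷ k ∷ k₁ ∷ k₂ ∷ h₁ ∷ h₂ ∷ []) = ruleHolds (letterAt z) (letterAt h) (letterAt h₁) (letterAt h₂)
  haltAt      (w ∷ h ∷ z ∷ c ∷ k ∷ k₁ ∷ k₂ ∷ h₁ ∷ h₂ ∷ []) = haltHolds (letterAt h₁) (letterAt z)
  everyColumn col = counterEnd col ∧ inputFits col ∧ historyEnd col ∧ ruleAt col ∧ haltAt col
  firstColumn (w ∷ h ∷ z ∷ c ∷ k ∷ k₁ ∷ k₂ ∷ h₁ ∷ h₂ ∷ []) = isSepᴹ (letterAt h) ∧ is-just k₂ ∧ startCell true w (letterAt h₁)
  laterColumn (w ∷ h ∷ z ∷ c ∷ k ∷ k₁ ∷ k₂ ∷ h₁ ∷ h₂ ∷ []) = is-just k₂ ⇒ᵇ startCell false w (letterAt h₁)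

  everyColumn-parts : ∀ col → everyColumn col ≡ true →
    counterEnd col ≡ true × inputFits col ≡ true × historyEnd col ≡ true × ruleAt col ≡ true × haltAt col ≡ true
  everyColumn-parts col e
    with e₁ , e ← ∧-true {counterEnd col} e
    with e₂ , e ← ∧-true {inputFits col} e
    with e₃ , e ← ∧-true {historyEnd col} e
    = e₁ , e₂ , e₃ , ∧-true {ruleAt col} e

  everyColumn-intro : ∀ col →
    counterEnd col ≡ true → inputFits col ≡ true → historyEnd col ≡ true → ruleAt col ≡ true → haltAt col ≡ true →
    everyColumn col ≡ true
  everyColumn-intro col e₁ e₂ e₃ e₄ e₅ = true-∧ e₁ (true-∧ e₂ (true-∧ e₃ (true-∧ e₄ e₅)))

  isSepᴹ-sound : ∀ {x} → isSepᴹ x ≡ true → x ≡ just sep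
  isSepᴹ-sound {just sep} _ = refl

  startCell-first : ∀ a x → startCell true a x ≡ true → ∃ λ mv → x ≡ just (head q₀ (inputAt a) mv)
  startCell-first a (just (cell t (just (q , mv)))) e with e₁ , e₂ ← ∧-true {t ≡ᵇ[ finite-TapeSym ] inputAt a} e
    = mv , cong₂ (λ t q → just (head q t mv)) (≡ᵇ-sound finite-TapeSym e₁) (≡ᵇ-sound finite-State e₂)
  startCell-first a (just (cell t nothing)) e with () ← proj₂ (∧-true {t ≡ᵇ[ finite-TapeSym ] inputAt a} e)

  startCell-later : ∀ a x → startCell false a x ≡ true → x ≡ just (plain (inputAt a))
  startCell-later a (just (cell t nothing)) e =
    cong (just ∘ plain) (≡ᵇ-sound finite-TapeSym (proj₁ (∧-true {t ≡ᵇ[ finite-TapeSym ] inputAt a} e)))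
  startCell-later a (just (cell t (just _))) e with () ← proj₂ (∧-true {t ≡ᵇ[ finite-TapeSym ] inputAt a} e)

  startCell-first-complete : ∀ a mv → startCell true a (just (head q₀ (inputAt a) mv)) ≡ true
  startCell-first-complete a mv = true-∧ (≡ᵇ-refl finite-TapeSym (inputAt a)) (≡ᵇ-refl finite-State q₀)

  startCell-later-complete : ∀ a → startCell false a (just (plain (inputAt a))) ≡ true
  startCell-later-complete a = true-∧ (≡ᵇ-refl finite-TapeSym (inputAt a)) refl

  ruleHolds-sound : ∀ z a b c → ruleHolds (just z) a b c ≡ true →
    ∃ λ a′ → ∃ λ b′ → ∃ λ c′ → a ≡ just a′ × b ≡ just b′ × c ≡ just c′ × rule a′ b′ c′ ≡ just (forgetMove z)
  ruleHolds-sound z (just a) (just b) (just c) e = a , b , c , refl , refl , refl , ≡ᵇ-sound finite-Letter⁻ e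

  ruleHolds-complete : ∀ x a b c → (∀ z → x ≡ just z →
    ∃ λ a′ → ∃ λ b′ → ∃ λ c′ → a ≡ just a′ × b ≡ just b′ × c ≡ just c′ × rule a′ b′ c′ ≡ just (forgetMove z)) →
    ruleHolds x a b c ≡ true
  ruleHolds-complete nothing  a b c h = refl
  ruleHolds-complete (just z) a b c h with _ , _ , _ , refl , refl , refl , e ← h z refl
    = subst (λ y → y ≡ᵇ[ finite-Letter⁻ ] just (forgetMove z) ≡ true) (sym e) (≡ᵇ-refl finite-Letter⁻ (just (forgetMove z)))

  haltHolds-complete : ∀ x z → (∀ q t mv → x ≡ just (head q t mv) → z ≡ nothing → accQ q ≡ true) → haltHolds x z ≡ true
  haltHolds-complete (just (cell t (just (q , mv)))) (just _) h = refl
  haltHolds-complete (just (cell t (just (q , mv)))) nothing  h = h q t mv refl refl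
  haltHolds-complete (just (cell t nothing))          z        h = refl
  haltHolds-complete (just sep)                       z        h = refl
  haltHolds-complete nothing                          z        h = refl

  module Check = Window finite-Γ (λ col → firstColumn col ∧ everyColumn col) (λ _ col → everyColumn col ∧ laterColumn col)

  abstract
    check : AutRel Γ 9
    check = Check.dfa

    check-accepts : ∀ xs → InAutRel check xs ⇔ Check.Accepted xs
    check-accepts = Check.dfa-accepts refl

  rW rH rZ rC rK rK₁ rK₂ rH₁ rH₂ : Fin 9
  rW = # 0
  rH = # 1
  rZ = # 2
  rC = # 3
  rK = # 4
  rK₁ = # 5
  rK₂ = # 6
  rH₁ = # 7
  rH₂ = # 8

  program : Vec (Instr s (size finite-Letter) 9 16) 16
  program = iRead rW
          ∷ iAssign rH universal
          ∷ iAssign rC universal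
          ∷ iCopy rK rC
          ∷ iAssign rK₁ (isTailOf finite-Γ rK)
          ∷ iAssign rK₂ (isTailOf finite-Γ rK₁)
          ∷ iAssign rH₁ (isTailOf finite-Γ rH)
          ∷ iAssign rH₂ (isTailOf finite-Γ rH₁)
          ∷ iCopy rZ rH
          ∷ iIfGoto (isEmpty finite-Γ rC) (# 13)
          ∷ iAssign rZ (isTailOf finite-Γ rZ)
          ∷ iAssign rC (isTailOf finite-Γ rC)
          ∷ iGoto (# 9)
          ∷ iIfGoto check (# 15)
          ∷ iReject
          ∷ iAccept
          ∷ []

  machine : UNARM s
  machine = record { k = size finite-Letter ; R = 9 ; len = 15 ; prog = lookup program }

module Runs {s : ℕ} (M : NTM s) (w : List (Fin s)) where
  open Machine M
  open Relations finite-Γ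
  open Steps machine w

  registers : (W H Z C K K₁ K₂ H₁ H₂ : List Γ) → Vec (List Γ) 9
  registers W H Z C K K₁ K₂ H₁ H₂ = W ∷ H ∷ Z ∷ C ∷ K ∷ K₁ ∷ K₂ ∷ H₁ ∷ H₂ ∷ []

  W : List Γ
  W = map inj₁ w

  loopRegisters : (H K Z C : List Γ) → Vec (List Γ) 9
  loopRegisters H K Z C = registers W H Z C K (tailL K) (tailL (tailL K)) (tailL H) (tailL (tailL H))

  finalRegisters : (H K : List Γ) → Vec (List Γ) 9
  finalRegisters H K = loopRegisters H K (drop (length K) H) []

  Checked : Set
  Checked = ∃ λ H → ∃ λ K → InAutRel check (finalRegisters H K)

  checked-at-13 : ∀ {t} H K → AcceptsWithin machine w t ⟨ # 13 , finalRegisters H K ⟩ → Checked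
  checked-at-13 H K a with _ , _ , refl , st , a′ ← AcceptsWithin-step (λ ()) a with step-effect st
  ... | inj₁ (passed , _) = H , K , passed
  ... | inj₂ (_ , _ , refl , refl) with _ , _ , refl , st′ , _ ← AcceptsWithin-step (λ ()) a′ with () ← step-effect st′

  checked-in-loop : ∀ {t} H K Z C e → e + length C ≡ length K → Z ≡ drop e H →
                    AcceptsWithin machine w t ⟨ # 9 , loopRegisters H K Z C ⟩ → Checked
  checked-in-loop H K Z C e len eZ a with _ , _ , refl , st , a′ ← AcceptsWithin-step (λ ()) a with step-effect st
  ... | inj₁ (empty , refl) with refl ← to (isEmpty-accepts rC (loopRegisters H K Z C)) empty =
    checked-at-13 H K (subst (λ X → AcceptsWithin machine w _ ⟨ # 13 , loopRegisters H K X [] ⟩)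
                             (trans eZ (cong (λ n → drop n H) (trans (sym (+-identityʳ e)) len))) a′)
  ... | inj₂ (nonempty , _ , refl , refl)
    with _ , _ , refl , st₁ , a₁ ← AcceptsWithin-step (λ ()) a′
    with Z′ , shiftZ , _ , refl , refl ← step-effect st₁
    with refl ← to (isTailOf-accepts rZ Z′ (loopRegisters H K Z C)) shiftZ
    with _ , _ , refl , st₂ , a₂ ← AcceptsWithin-step (λ ()) a₁
    with C′ , shiftC , _ , refl , refl ← step-effect st₂
    with refl ← to (isTailOf-accepts rC C′ (loopRegisters H K (tailL Z) C)) shiftC
    with _ , _ , refl , st₃ , a₃ ← AcceptsWithin-step (λ ()) a₂
    with refl ← step-effect st₃
    = checked-in-loop H K (tailL Z) (tailL C) (suc e) one-less (trans (cong tailL eZ) (tail-drop e H)) a₃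
    where
    one-less : suc e + length (tailL C) ≡ length K
    one-less = trans (sym (+-suc e _)) (trans (cong (e +_) (length-tailL C (nonempty ∘ from (isEmpty-accepts rC (loopRegisters H K Z C))))) len)

  accepts⇒checked : ∀ {t} → AcceptsWithin machine w t (rInit machine) → Checked
  accepts⇒checked a₀
    with _ , _ , refl , st₀ , a₁ ← AcceptsWithin-step (λ ()) a₀
    with _ , refl , refl ← step-effect st₀
    with _ , _ , refl , st₁ , a₂ ← AcceptsWithin-step (λ ()) a₁
    with H , _ , _ , refl , refl ← step-effect st₁
    with _ , _ , refl , st₂ , a₃ ← AcceptsWithin-step (λ ()) a₂
    with C , _ , _ , refl , refl ← step-effect st₂
    with _ , _ , refl , st₃ , a₄ ← AcceptsWithin-step (λ ()) a₃
    with _ , refl , refl ← step-effect st₃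
    with _ , _ , refl , st₄ , a₅ ← AcceptsWithin-step (λ ()) a₄
    with K₁ , shift₁ , _ , refl , refl ← step-effect st₄
    with refl ← to (isTailOf-accepts rK K₁ (registers W H [] C C [] [] [] [])) shift₁
    with _ , _ , refl , st₅ , a₆ ← AcceptsWithin-step (λ ()) a₅
    with K₂ , shift₂ , _ , refl , refl ← step-effect st₅
    with refl ← to (isTailOf-accepts rK₁ K₂ (registers W H [] C C (tailL C) [] [] [])) shift₂
    with _ , _ , refl , st₆ , a₇ ← AcceptsWithin-step (λ ()) a₆
    with H₁ , shift₃ , _ , refl , refl ← step-effect st₆
    with refl ← to (isTailOf-accepts rH H₁ (registers W H [] C C (tailL C) (tailL (tailL C)) [] [])) shift₃
    with _ , _ , refl , st₇ , a₈ ← AcceptsWithin-step (λ ()) a₇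
    with H₂ , shift₄ , _ , refl , refl ← step-effect st₇
    with refl ← to (isTailOf-accepts rH₁ H₂ (registers W H [] C C (tailL C) (tailL (tailL C)) (tailL H) [])) shift₄
    with _ , _ , refl , st₈ , a₉ ← AcceptsWithin-step (λ ()) a₈
    with _ , refl , refl ← step-effect st₈
    = checked-in-loop H C H C 0 refl refl a₉

  module _ (H K : List Γ) (passed : InAutRel check (finalRegisters H K)) where

    run-loop : ∀ C e Z → e + length C ≡ length K → Z ≡ drop e H →
               AcceptsWithin machine w (length C * 4 + 3) ⟨ # 9 , loopRegisters H K Z C ⟩
    run-loop [] e Z len eZ =
      there (sIfYes refl (from (isEmpty-accepts rC (loopRegisters H K Z [])) refl))
        (subst (λ X → AcceptsWithin machine w 2 ⟨ # 13 , loopRegisters H K X [] ⟩)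
               (sym (trans eZ (cong (λ n → drop n H) (trans (sym (+-identityʳ e)) len))))
               (there (sIfYes refl passed) (here refl)))
    run-loop (c ∷ C) e Z len eZ =
      there (sIfNo refl (λ empty → ∷≢[] (to (isEmpty-accepts rC (loopRegisters H K Z (c ∷ C))) empty)) refl)
      (there (sAssign (tailL Z) refl (from (isTailOf-accepts rZ (tailL Z) (loopRegisters H K Z (c ∷ C))) refl) refl)
      (there (sAssign C refl (from (isTailOf-accepts rC C (loopRegisters H K (tailL Z) (c ∷ C))) refl) refl)
      (there (sGoto refl)
      (run-loop C (suc e) (tailL Z) (trans (sym (+-suc e (length C))) len) (trans (cong tailL eZ) (tail-drop e H))))))
      where
      ∷≢[] : c ∷ C ≢ []
      ∷≢[] ()

    accepting-run : AcceptsWithin machine w (9 + (length K * 4 + 3)) (rInit machine)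
    accepting-run =
      there (sRead refl refl)
      (there (sAssign H refl (universal-accepts (conv (H ∷ registers W [] [] [] [] [] [] [] []))) refl)
      (there (sAssign K refl (universal-accepts (conv (K ∷ registers W H [] [] [] [] [] [] []))) refl)
      (there (sCopy refl refl)
      (there (sAssign (tailL K) refl (from (isTailOf-accepts rK _ (registers W H [] K K [] [] [] [])) refl) refl)
      (there (sAssign (tailL (tailL K)) refl (from (isTailOf-accepts rK₁ _ (registers W H [] K K (tailL K) [] [] [])) refl) refl)
      (there (sAssign (tailL H) refl (from (isTailOf-accepts rH _ (registers W H [] K K (tailL K) (tailL (tailL K)) [] [])) refl) refl)
      (there (sAssign (tailL (tailL H)) refl
                (from (isTailOf-accepts rH₁ _ (registers W H [] K K (tailL K) (tailL (tailL K)) (tailL H) [])) refl) refl)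
      (there (sCopy refl refl)
      (run-loop K 0 H refl refl)))))))))

module Certificates {s : ℕ} (M : NTM s) (w : List (Fin s)) where
  open NTM M
  open Encoding M
  open Frames M
  open Machine M
  open Runs M w

  columnAt : List Γ → List Γ → ℕ → Column
  columnAt H K j = W ! j ∷ H ! j ∷ H ! (length K + j) ∷ nothing ∷ K ! j ∷ K ! suc j ∷ K ! suc (suc j)
                 ∷ H ! suc j ∷ H ! suc (suc j) ∷ []

  column-finalRegisters : ∀ H K j → column j (finalRegisters H K) ≡ columnAt H K j
  column-finalRegisters H K j
    rewrite !-drop (length K) H j | !-tail K j | !-tail (tailL K) j | !-tail K (suc j)
          | !-tail H j | !-tail (tailL H) j | !-tail H (suc j) = refl

  record Certificate (H K : List Γ) : Set where
    field
      first : firstColumn (columnAt H K 0) ≡ true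
      every : ∀ j → everyColumn (columnAt H K j) ≡ true
      later : ∀ j → laterColumn (columnAt H K (suc j)) ≡ true

  checked⇔certificate : ∀ H K → InAutRel check (finalRegisters H K) ⇔ Certificate H K
  checked⇔certificate H K = mk⇔
    (λ passed → let (h₀ , h) = to (check-accepts (finalRegisters H K)) passed
                    (f , e₀) = ∧-true (to (via first∧every 0) h₀) in
      record { first = f
             ; every = λ { zero → e₀ ; (suc j) → proj₁ (∧-true (to (via every∧later (suc j)) (h j))) }
             ; later = λ j → proj₂ (∧-true (to (via every∧later (suc j)) (h j))) })
    (λ cert → from (check-accepts (finalRegisters H K))
      ( from (via first∧every 0) (true-∧ (Certificate.first cert) (Certificate.every cert 0))
      , λ j → from (via every∧later (suc j)) (true-∧ (Certificate.every cert (suc j)) (Certificate.later cert j))))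
    where
    first∧every every∧later : Column → Bool
    first∧every col = firstColumn col ∧ everyColumn col
    every∧later col = everyColumn col ∧ laterColumn col
    via : ∀ (P : Column → Bool) j → P (column j (finalRegisters H K)) ≡ true ⇔ P (columnAt H K j) ≡ true
    via P j = mk⇔ (subst (λ col → P col ≡ true) (column-finalRegisters H K j))
                  (subst (λ col → P col ≡ true) (sym (column-finalRegisters H K j)))

  startHeadAt : ℕ → Move → Maybe (State × Move)
  startHeadAt zero    mv = just (q₀ , mv)
  startHeadAt (suc _) mv = nothing

  !-padded-input : ∀ (v : List (Fin s)) r {i} → i < length v + r →
                   (map (λ a → just (inj₁ a)) v ++ replicate r nothing) ! i ≡ just (inputAt (map inj₁ v ! i))
  !-padded-input []      r       i<r     = !-replicate r nothing i<r
  !-padded-input (a ∷ v) r {zero}  _       = refl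
  !-padded-input (a ∷ v) r {suc i} (s≤s p) = !-padded-input v r p

  initial-frame′ : ∀ v m mv {i} → length v ≤ m → i < m →
    encode (frameOf m (tInit M v)) mv ! i ≡ just (cell (inputAt (map inj₁ v ! i)) (startHeadAt i mv))
  initial-frame′ []      m mv {zero}  _ _ = refl
  initial-frame′ (a ∷ v) m mv {zero}  _ _ = refl
  initial-frame′ [] (suc m) mv {suc i} _ (s≤s i<m) = !-map-just plain (replicate m nothing) (!-replicate m nothing i<m)
  initial-frame′ (a ∷ v) (suc m) mv {suc i} (s≤s lv) (s≤s i<m) = !-map-just plain (map (λ a → just (inj₁ a)) v ++ replicate _ nothing) (!-padded-input v _ bound)
    where
    bound : i < length v + (m ∸ length (map (λ a → just (inj₁ a)) v))
    bound = subst (λ n → i < length v + (m ∸ n)) (sym (length-map _ v)) (subst (i <_) (sym (m+[n∸m]≡n lv)) i<m)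

  initial-frame : ∀ m mv {i} → length w ≤ m → i < m →
                  encode (frameOf m (tInit M w)) mv ! i ≡ just (cell (inputAt (W ! i)) (startHeadAt i mv))
  initial-frame = initial-frame′ w

module CertificateSoundness {s : ℕ} (M : NTM s) (w : List (Fin s)) where
  open NTM M
  open Encoding M
  open Frames M
  open Machine M
  open Runs M w
  open Certificates M w

  module _ (H K : List Γ) (cert : Certificate H K) (m : ℕ) (lK : length K ≡ suc (suc m)) (1≤m : 1 ≤ m) where
    open Certificate cert
    open Histories M m

    Hs : List Letter
    Hs = map fromΓ H

    letters : ∀ (P : Maybe Letter → Maybe Letter → Maybe Letter → Maybe Letter → Set) i j k l →
              P (letterAt (H ! i)) (letterAt (H ! j)) (letterAt (H ! k)) (letterAt (H ! l)) → P (Hs ! i) (Hs ! j) (Hs ! k) (Hs ! l)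
    letters P i j k l p
      rewrite !-map fromΓ H i | !-map fromΓ H j | !-map fromΓ H k | !-map fromΓ H l = p

    K-defined : ∀ {j} → j < suc (suc m) → is-just (K ! j) ≡ true
    K-defined {j} j<len = <⇒is-just-! K (subst (j <_) (sym lK) j<len)

    K-ends : K ! suc (suc m) ≡ nothing
    K-ends = !-≥ K (≤-reflexive lK)

    sep-first : Hs ! 0 ≡ just sep
    sep-first = letters (λ x _ _ _ → x ≡ just sep) 0 0 0 0 (isSepᴹ-sound (proj₁ (∧-true {isSepᴹ (letterAt (H ! 0))} first)))

    sep-after-block : Hs ! suc m ≡ just sep
    sep-after-block = letters (λ x _ _ _ → x ≡ just sep) (suc m) 0 0 0
      (isSepᴹ-sound (⇒ᵇ-elim (proj₁ (everyColumn-parts (columnAt H K (suc m)) (every (suc m)))) premise))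
      where
      premise : is-just (K ! suc m) ∧ not (is-just (K ! suc (suc m))) ≡ true
      premise rewrite K-defined {suc m} ≤-refl | K-ends = refl

    input-fits : length w ≤ m
    input-fits with length w ≤? m
    ... | yes fits = fits
    ... | no ¬fits with () ← trans (sym (cong is-just K-ends)) (⇒ᵇ-elim (proj₁ (proj₂ (everyColumn-parts (columnAt H K m) (every m))))
                                    (<⇒is-just-! W (subst (m <_) (sym (length-map inj₁ w)) (≰⇒> ¬fits))))

    start : ∃ λ mv → letterAt (H ! 1) ≡ just (head q₀ (inputAt (W ! 0)) mv)
    start = startCell-first (W ! 0) _ (proj₂ (∧-true {is-just (K ! 2)} (proj₂ (∧-true {isSepᴹ (letterAt (H ! 0))} first))))

    E : List Letter
    E = encode (frameOf m (tInit M w)) (proj₁ start)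

    lE : length E ≡ m
    lE = length-encode (tInit M w) (proj₁ start) (space-tInit w 1≤m input-fits)

    block : ∀ {i} → i < m → Hs ! suc i ≡ E ! i
    block {zero} i<m =
      trans (letters (λ _ x _ _ → x ≡ just (head q₀ (inputAt (W ! 0)) (proj₁ start))) 0 1 0 0 (proj₂ start)) (sym (initial-frame m (proj₁ start) input-fits i<m))
    block {suc i} i<m =
      trans (letters (λ _ x _ _ → x ≡ just (plain (inputAt (W ! suc i)))) 0 (suc (suc i)) 0 0
                     (startCell-later (W ! suc i) _ (⇒ᵇ-elim (later i) (K-defined (s≤s (s≤s i<m))))))
            (sym (initial-frame m (proj₁ start) input-fits i<m))

    R : List Letter
    R = drop (length (⟪ E ⟫ [])) Hs

    Hs≡ : Hs ≡ ⟪ E ⟫ R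
    Hs≡ = trans (!-prefix (⟪ E ⟫ []) Hs long agree) (cong (sep ∷_) (++-assoc E (sep ∷ []) R))
      where
      open Block E [] lE
      long : length (⟪ E ⟫ []) ≤ length Hs
      long = subst (_≤ length Hs) (sym (length-⟪⟫[] E lE)) (!-just⇒< Hs (suc m) sep-after-block)
      agree : ∀ j → j < length (⟪ E ⟫ []) → Hs ! j ≡ (⟪ E ⟫ []) ! j
      agree zero    _ = sep-first
      agree (suc i) p with <-cmp i m
      ... | tri< i<m _ _ = trans (block i<m) (sym (L-block i<m))
      ... | tri≈ _ refl _ = trans sep-after-block (sym L-sep)
      ... | tri> _ _ m<i = ⊥-elim (<⇒≱ m<i (s≤s⁻¹ (s≤s⁻¹ (subst (suc i <_) (length-⟪⟫[] E lE) p))))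

    valid : Valid Hs
    valid = record { followsRule = follows ; endsWithSep = ends ; haltsAccepting = halts }
      where
      parts : ∀ j → _
      parts j = everyColumn-parts (columnAt H K j) (every j)
      follows : FollowsRule Hs
      follows j z e = ruleHolds-sound z _ _ _ (subst (λ x → ruleHolds x (Hs ! j) (Hs ! suc j) (Hs ! suc (suc j)) ≡ true) e
        (subst (λ n → ruleHolds (Hs ! (n + j)) (Hs ! j) (Hs ! suc j) (Hs ! suc (suc j)) ≡ true) lK
          (letters (λ x a b c → ruleHolds x a b c ≡ true) (length K + j) j (suc j) (suc (suc j))
            (proj₁ (proj₂ (proj₂ (proj₂ (parts j))))))))
      ends : EndsWithSep Hs
      ends j x e e′ = just-injective (trans (sym e) (isSepᴹ-sound (⇒ᵇ-elim end premise)))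
        where
        end : (is-just (Hs ! j) ∧ not (is-just (Hs ! suc j)) ⇒ᵇ isSepᴹ (Hs ! j)) ≡ true
        end = letters (λ x y _ _ → (is-just x ∧ not (is-just y) ⇒ᵇ isSepᴹ x) ≡ true) j (suc j) 0 0 (proj₁ (proj₂ (proj₂ (parts j))))
        premise : is-just (Hs ! j) ∧ not (is-just (Hs ! suc j)) ≡ true
        premise rewrite e | e′ = refl
      halts : HaltsAccepting Hs
      halts j q t mv e e′ =
        subst₂ (λ x z → haltHolds x z ≡ true) e e′
          (subst (λ n → haltHolds (Hs ! suc j) (Hs ! (n + j)) ≡ true) lK
            (letters (λ x z _ _ → haltHolds x z ≡ true) (suc j) (length K + j) 0 0 (proj₂ (proj₂ (proj₂ (proj₂ (parts j)))))))

    accepts : TAccepts M w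
    accepts = sound (length Hs) (tInit M w) (proj₁ start) R (space-tInit w 1≤m input-fits)
                    (≤-reflexive (cong length (sym Hs≡))) (subst Valid Hs≡ valid)

  certificate⇒accepts : ∀ H K → Certificate H K → TAccepts M w
  certificate⇒accepts H K cert = accepts H K cert (length K ∸ 2) (sym (m+[n∸m]≡n 2≤len)) (∸-monoˡ-≤ 2 3≤len)
    where
    3≤len : 3 ≤ length K
    3≤len = is-just-!⇒< K 2 (proj₁ (∧-true {is-just (K ! 2)} (proj₂ (∧-true {isSepᴹ (letterAt (H ! 0))} (Certificate.first cert)))))
    2≤len : 2 ≤ length K
    2≤len = ≤-trans (n≤1+n 2) 3≤len

module CertificateCompleteness {s : ℕ} (M : NTM s) (w : List (Fin s)) (m : ℕ) (1≤m : 1 ≤ m) (lw : length w ≤ m)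
                               {c : TConfig M} (run : Star (TStep M) (tInit M w) c) (sp : space M c ≤ m)
                               (acc : NTM.accQ M (TConfig.st c) ≡ true) where
  open NTM M
  open Encoding M
  open Frames M
  open Machine M
  open Runs M w
  open Certificates M w
  open Histories M m
  open Completeness M m

  Hs : List Letter
  Hs = history run sp

  H K : List Γ
  H = map toΓ Hs
  K = replicate (suc (suc m)) (toΓ sep)

  length-K : length K ≡ suc (suc m)
  length-K = length-replicate (suc (suc m))

  letter : ∀ j → letterAt (H ! j) ≡ Hs ! j
  letter j rewrite !-map toΓ Hs j with Hs ! j
  ... | nothing = refl
  ... | just x  = cong just (fromΓ-toΓ x)

  letters : ∀ (P : Maybe Letter → Maybe Letter → Maybe Letter → Maybe Letter → Set) i j k l →
            P (Hs ! i) (Hs ! j) (Hs ! k) (Hs ! l) → P (letterAt (H ! i)) (letterAt (H ! j)) (letterAt (H ! k)) (letterAt (H ! l))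
  letters P i j k l p rewrite letter i | letter j | letter k | letter l = p

  K-defined : ∀ {j} → j < suc (suc m) → is-just (K ! j) ≡ true
  K-defined {j} j<len = <⇒is-just-! K (subst (j <_) (sym length-K) j<len)

  K-defined⁻¹ : ∀ {j} → is-just (K ! j) ≡ true → j < suc (suc m)
  K-defined⁻¹ {j} e = subst (j <_) length-K (is-just-!⇒< K j e)

  valid : Valid Hs
  valid = history-valid run sp acc

  mv₀ : Move
  mv₀ = proj₁ (history-⟪⟫ run sp)

  E : List Letter
  E = encode (frameOf m (tInit M w)) mv₀

  lE : length E ≡ m
  lE = length-encode (tInit M w) mv₀ (≤-trans (space-run run) sp)

  open Block E (proj₁ (proj₂ (history-⟪⟫ run sp))) lE

  Hs≡ : Hs ≡ L
  Hs≡ = proj₂ (proj₂ (history-⟪⟫ run sp))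

  Hs-block : ∀ {i} → i < m → Hs ! suc i ≡ E ! i
  Hs-block {i} i<m = trans (cong (_! suc i) Hs≡) (L-block i<m)

  Hs-sep : Hs ! suc m ≡ just sep
  Hs-sep = trans (cong (_! suc m) Hs≡) L-sep

  first-holds : firstColumn (columnAt H K 0) ≡ true
  first-holds = true-∧ (letters (λ x _ _ _ → isSepᴹ x ≡ true) 0 0 0 0 refl)
                       (true-∧ (K-defined (s≤s (s≤s 1≤m)))
                               (letters (λ _ x _ _ → startCell true (W ! 0) x ≡ true) 0 1 0 0
                                 (subst (λ x → startCell true (W ! 0) x ≡ true)
                                        (sym (trans (Hs-block 1≤m) (initial-frame m mv₀ lw 1≤m)))
                                        (startCell-first-complete (W ! 0) mv₀))))

  later-holds : ∀ j → laterColumn (columnAt H K (suc j)) ≡ true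
  later-holds j = ⇒ᵇ-intro λ defined → let j<m = s≤s⁻¹ (s≤s⁻¹ (K-defined⁻¹ defined)) in
    letters (λ _ x _ _ → startCell false (W ! suc j) x ≡ true) 0 (suc (suc j)) 0 0
      (subst (λ x → startCell false (W ! suc j) x ≡ true) (sym (trans (Hs-block j<m) (initial-frame m mv₀ lw j<m)))
             (startCell-later-complete (W ! suc j)))

  counterEnd-holds : ∀ j → counterEnd (columnAt H K j) ≡ true
  counterEnd-holds j = ⇒ᵇ-intro λ premise → let (defined , undefined) = ∧-true {is-just (K ! j)} premise in
    letters (λ x _ _ _ → isSepᴹ x ≡ true) j 0 0 0
      (subst (λ i → isSepᴹ (Hs ! i) ≡ true) (sym (last-index defined undefined)) (cong isSepᴹ Hs-sep))
    where
    last-index : is-just (K ! j) ≡ true → not (is-just (K ! suc j)) ≡ true → j ≡ suc m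
    last-index defined undefined with <-cmp (suc j) (suc (suc m))
    ... | tri< sj<len _ _ with () ← trans (sym undefined) (cong not (K-defined sj<len))
    ... | tri≈ _ refl _ = refl
    ... | tri> _ _ len<sj = ⊥-elim (<⇒≱ (K-defined⁻¹ defined) (s≤s⁻¹ len<sj))

  inputFits-holds : ∀ j → inputFits (columnAt H K j) ≡ true
  inputFits-holds j = ⇒ᵇ-intro λ defined →
    K-defined (s≤s (s≤s (≤-trans (subst (j <_) (length-map inj₁ w) (is-just-!⇒< W j defined)) lw)))

  historyEnd-holds : ∀ j → historyEnd (columnAt H K j) ≡ true
  historyEnd-holds j = letters (λ x y _ _ → (is-just x ∧ not (is-just y) ⇒ᵇ isSepᴹ x) ≡ true) j (suc j) 0 0 ends
    where
    ends : (is-just (Hs ! j) ∧ not (is-just (Hs ! suc j)) ⇒ᵇ isSepᴹ (Hs ! j)) ≡ true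
    ends with Hs ! j in e | Hs ! suc j in e′
    ... | nothing | _      = refl
    ... | just _  | just _ = refl
    ... | just x  | nothing rewrite Valid.endsWithSep valid j x e e′ = refl

  ruleAt-holds : ∀ j → ruleAt (columnAt H K j) ≡ true
  ruleAt-holds j = letters (λ x a b c → ruleHolds x a b c ≡ true) (length K + j) j (suc j) (suc (suc j))
    (subst (λ n → ruleHolds (Hs ! (n + j)) (Hs ! j) (Hs ! suc j) (Hs ! suc (suc j)) ≡ true) (sym length-K)
      (ruleHolds-complete _ _ _ _ (λ z e → Valid.followsRule valid j z e)))

  haltAt-holds : ∀ j → haltAt (columnAt H K j) ≡ true
  haltAt-holds j = letters (λ x z _ _ → haltHolds x z ≡ true) (suc j) (length K + j) 0 0
    (subst (λ n → haltHolds (Hs ! suc j) (Hs ! (n + j)) ≡ true) (sym length-K)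
      (haltHolds-complete _ _ (λ q t mv e e′ → Valid.haltsAccepting valid j q t mv e e′)))

  certificate : Certificate H K
  certificate = record
    { first = first-holds
    ; every = λ j → everyColumn-intro (columnAt H K j) (counterEnd-holds j) (inputFits-holds j) (historyEnd-holds j) (ruleAt-holds j) (haltAt-holds j)
    ; later = later-holds }

module Simulation {s : ℕ} (M : NTM s) where
  open Machine M

  space-positive : ∀ c → 1 ≤ space M c
  space-positive (tc _ ls _ rs) = ≤-trans (s≤s z≤n) (m≤n+m (suc (length rs)) (length ls))

  accepts-in-time : ∀ w {m} → 1 ≤ m → length w ≤ m → AcceptsInSpace M w m → AcceptsWithin machine w (20 + m * 4) (rInit machine)
  accepts-in-time w {m} 1≤m lw (c , run , acc , sp) =
    subst (λ t → AcceptsWithin machine w t (rInit machine)) time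
      (Runs.accepting-run M w H K (from (Certificates.checked⇔certificate M w H K) certificate))
    where
    open CertificateCompleteness M w m 1≤m lw run sp acc
    time : 9 + (length K * 4 + 3) ≡ 20 + m * 4
    time = trans (cong (λ n → 9 + (n * 4 + 3)) length-K) (cong (17 +_) (+-comm (m * 4) 3))

  simulation : ∀ w → TAccepts M w ⇔ UAccepts machine w
  simulation w = mk⇔
    (λ (c , run , acc) → _ , accepts-in-time w (≤-trans (space-positive c) (m≤m+n (space M c) (length w)))
                                               (m≤n+m (length w) (space M c)) (c , run , acc , m≤m+n (space M c) (length w)))
    (λ (_ , a) → let (H , K , passed) = Runs.accepts⇒checked M w a in
                 CertificateSoundness.certificate⇒accepts M w H K (to (Certificates.checked⇔certificate M w H K) passed))

-- a run in space c₁ F, padded to space c₁ F + n for the input, is simulated in 20 + 4 (c₁ F + n) steps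
linear-time : ∀ c₀ c₁ n F → n ≤ c₀ * F → 1 ≤ F → 20 + (c₁ * F + n) * 4 ≤ (20 + (c₁ + c₀) * 4) * F
linear-time c₀ c₁ n F n≤ 1≤F = begin
    20 + (c₁ * F + n) * 4           ≤⟨ +-mono-≤ (*-monoʳ-≤ 20 1≤F) (*-monoˡ-≤ 4 (+-monoʳ-≤ (c₁ * F) n≤)) ⟩
    20 * F + (c₁ * F + c₀ * F) * 4  ≡⟨ solve 3 (λ a b f → con 20 :* f :+ (b :* f :+ a :* f) :* con 4 := (con 20 :+ (b :+ a) :* con 4) :* f) refl c₀ c₁ F ⟩
    (20 + (c₁ + c₀) * 4) * F        ∎
  where
  open ≤-Reasoning
  open +-*-Solver

mainTheorem15 : (f : ℕ → ℕ) → IsΩn f →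
    ∀ (s : ℕ) (L : Language s) → NSPACE f L → UNAL f L
mainTheorem15 f (c₀ , n₀ , input-small) s L (M , L⇔M , c₁ , n₁ , space-small) =
  machine , (λ w → simulation w ⇔-∘ L⇔M w) , 20 + (c₁ + c₀) * 4 , suc (n₀ + n₁) , fast
  where
  open Machine M
  open Simulation M
  fast : ∀ w → suc (n₀ + n₁) ≤ length w → L w →
         AcceptsWithin machine w ((20 + (c₁ + c₀) * 4) * f (length w)) (rInit machine)
  fast w long Lw with c , run , acc , sp ← space-small w (≤-trans (m≤n+m n₁ n₀) (<⇒≤ long)) Lw =
    Steps.AcceptsWithin-mono machine w (linear-time c₀ c₁ n F n≤c₀F 1≤F)
      (accepts-in-time w (≤-trans 1≤n (m≤n+m n (c₁ * F))) (m≤n+m n (c₁ * F)) (c , run , acc , ≤-trans sp (m≤m+n (c₁ * F) n)))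
    where
    n = length w
    F = f n
    n≤c₀F : n ≤ c₀ * F
    n≤c₀F = input-small n (≤-trans (m≤m+n n₀ n₁) (<⇒≤ long))
    1≤n : 1 ≤ n
    1≤n = ≤-trans (s≤s z≤n) long
    1≤F : 1 ≤ F
    1≤F = n≢0⇒n>0 λ F≡0 → <⇒≱ 1≤n (≤-trans n≤c₀F (≤-reflexive (trans (cong (c₀ *_) F≡0) (*-zeroʳ c₀))))
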